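{- Let $p$ be a prime and let $0\le s\le S$ be integers; in the case $p=2$ and $s\ge 2$, assume moreover $2s+1\le S$. Then there exist monic polynomials $f,g\in\mathbb{Z}[x]$ with nonzero resultant $r$ such that $\min_{n\in\mathbb{Z}}v(\gcd(f(n),g(n)))=s$, $\max_{n\in\mathbb{Z}}v(\gcd(f(n),g(n)))=S$, and $v(r)-S=ps^2-s$.
   Context: For a nonzero integer $a$, $v(a)$ is the exponent of $p$ in the prime factorization of $a$. The resultant is the determinant of the Sylvester matrix of $f$ and $g$. -}

module Defs where

open import Data.Nat as ℕ using (ℕ; zero; suc; _≤ᵇ_; _<ᵇ_; _∸_)
open import Data.Integer as ℤ using (ℤ; +_; -_; _*_; _+_; 0ℤ; 1ℤ)
open import Data.Integer.Divisibility using (_∣_)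
open import Data.Integer.GCD using (gcd)
open import Data.Fin using (Fin; toℕ; punchIn)
import Data.Fin as F
open import Data.List using (List; []; _∷_; length; last)
open import Data.Maybe using (Maybe; just)
open import Data.Bool using (if_then_else_; _∧_)
open import Data.Product using (Σ; ∃; _×_)
open import Relation.Binary.PropositionalEquality using (_≡_; _≢_)
open import Relation.Nullary using (¬_)

-- Polynomials in ℤ[x] as coefficient lists, lowest degree first:
-- a₀ ∷ a₁ ∷ … ∷ aₘ represents a₀ + a₁ x + … + aₘ xᵐ.
Poly : Set
Poly = List ℤ

Monic : Poly → Set
Monic f = last f ≡ just 1ℤ

-- degree (meaningful for monic polynomials, whose last coefficient is 1 ≠ 0)
deg : Poly → ℕ
deg f = length f ∸ 1

coeff : Poly → ℕ → ℤ
coeff []       _       = 0ℤ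
coeff (a ∷ _)  zero    = a
coeff (_ ∷ as) (suc k) = coeff as k

eval : Poly → ℤ → ℤ
eval []       x = 0ℤ
eval (a ∷ as) x = a + x * eval as x

sumFin : ∀ n → (Fin n → ℤ) → ℤ
sumFin zero    h = 0ℤ
sumFin (suc n) h = h F.zero + sumFin n (λ j → h (F.suc j))

sign : ℕ → ℤ
sign zero          = 1ℤ
sign (suc zero)    = - 1ℤ
sign (suc (suc k)) = sign k

det : ∀ n → (Fin n → Fin n → ℤ) → ℤ
det zero    A = 1ℤ
det (suc n) A = sumFin (suc n) (λ j →
  sign (toℕ j) * (A F.zero j * det n (λ i k → A (F.suc i) (punchIn j k))))

-- Sylvester matrix of f (degree m) and g (degree n), of size m + n:
-- rows 0..n-1 carry the coefficients aₘ,…,a₀ of f shifted right by the row index,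
-- rows n..n+m-1 carry the coefficients bₙ,…,b₀ of g shifted right by (row - n).
sylvesterEntry : Poly → Poly → ℕ → ℕ → ℤ
sylvesterEntry f g i j =
  if i <ᵇ deg g
  then (if (i ≤ᵇ j) ∧ (j ≤ᵇ i ℕ.+ deg f) then coeff f (i ℕ.+ deg f ∸ j) else 0ℤ)
  else (if ((i ∸ deg g) ≤ᵇ j) ∧ (j ≤ᵇ (i ∸ deg g) ℕ.+ deg g)
        then coeff g ((i ∸ deg g) ℕ.+ deg g ∸ j) else 0ℤ)

sylvester : (f g : Poly) → Fin (deg f ℕ.+ deg g) → Fin (deg f ℕ.+ deg g) → ℤ
sylvester f g i j = sylvesterEntry f g (toℕ i) (toℕ j)

resultant : Poly → Poly → ℤ
resultant f g = det (deg f ℕ.+ deg g) (sylvester f g)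

IsVal : ℕ → ℤ → ℕ → Set
IsVal p a k = (a ≢ 0ℤ) × (+ (p ℕ.^ k) ∣ a) × ¬ (+ (p ℕ.^ suc k) ∣ a)

MinVal : ℕ → (ℤ → ℤ) → ℕ → Set
MinVal p h s = (∀ n → ∃ λ k → IsVal p (h n) k)
             × (∀ n k → IsVal p (h n) k → s ℕ.≤ k)
             × (∃ λ n → IsVal p (h n) s)

MaxVal : ℕ → (ℤ → ℤ) → ℕ → Set
MaxVal p h S = (∀ n → ∃ λ k → IsVal p (h n) k)
             × (∀ n k → IsVal p (h n) k → k ℕ.≤ S)
             × (∃ λ n → IsVal p (h n) S)

gcdAt : Poly → Poly → ℤ → ℤ
gcdAt f g n = gcd (eval f n) (eval g n)

module Submission where

-- Every construction has the shape  f = ∏_{r ∈ rs} (x - r),  g = f + h  with deg h < deg f.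
-- Then g is monic, gcd(f n, g n) = gcd(f n, f n + h n), and Res(f, g) = ∏_{r ∈ rs} h(r).

open import Defs
open import Data.Nat as ℕ using (ℕ; zero; suc; _≤_; _<_; z≤n; s≤s; _≤ᵇ_; _<ᵇ_; _∸_; _⊔_)
import Data.Nat.Properties as NP
import Data.Nat.Divisibility as ND
import Data.Nat.GCD as NG
import Data.Nat.Tactic.RingSolver as NRS
open import Data.Nat.Primality using (Prime; euclidsLemma; prime⇒nonTrivial)
open import Data.Integer as ℤ using (ℤ; +_; -_; _*_; _+_; _-_; 0ℤ; 1ℤ)
import Data.Integer.Properties as ℤP
import Data.Integer.DivMod as DM
import Data.Integer.Divisibility as U
open import Data.Integer.Divisibility.Signed
  using (_∣_; _∣?_; divides; ∣-refl; ∣-trans; ∣m+n∣m⇒∣n; ∣m+n∣n⇒∣m; ∣m⇒∣m*n; ∣n⇒∣m*n;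
         ∣m∣n⇒∣m+n; ∣m∣n⇒∣m-n; ∣ᵤ⇒∣; ∣⇒∣ᵤ; *-cancelˡ-∣; *-monoˡ-∣)
open import Data.Integer.GCD using (gcd; gcd[i,j]∣i; gcd[i,j]∣j; gcd-greatest; gcd-zeroˡ)
open import Data.Integer.Tactic.RingSolver using (solve-∀)
open import Data.Fin as F using (Fin; toℕ; punchIn; inject₁; fromℕ; fromℕ<)
import Data.Fin.Properties as FP
open import Data.List using (List; []; _∷_; length; last; _++_)
import Data.List.Properties as LP
open import Data.List.Relation.Unary.All as All using (All; []; _∷_)
open import Data.Bool using (Bool; true; false; if_then_else_; _∧_; T)
open import Data.Unit using (tt)
open import Data.Product using (Σ; ∃; _×_; _,_; proj₁; proj₂)
open import Data.Sum using (_⊎_; inj₁; inj₂; [_,_]′)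
open import Data.Empty using (⊥; ⊥-elim)
open import Relation.Nullary using (¬_; yes; no)
open import Relation.Binary using (tri<; tri≈; tri>)
open import Relation.Binary.PropositionalEquality

Mat : ℕ → Set
Mat n = Fin n → Fin n → ℤ

sg : ∀ {n} → Fin n → ℤ
sg j = sign (toℕ j)

minor : ∀ {n} → Mat (suc n) → Fin (suc n) → Mat n
minor A j i k = A (F.suc i) (punchIn j k)

transpose : ∀ {n} → Mat n → Mat n
transpose A i j = A j i

sign-suc : ∀ k → sign (suc k) ≡ - sign k
sign-suc zero = refl
sign-suc (suc zero) = refl
sign-suc (suc (suc k)) = sign-suc k

sumFin-ext : ∀ n {h h' : Fin n → ℤ} → (∀ j → h j ≡ h' j) → sumFin n h ≡ sumFin n h'
sumFin-ext zero eq = refl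
sumFin-ext (suc n) eq = cong₂ _+_ (eq F.zero) (sumFin-ext n (λ j → eq (F.suc j)))

sumFin-0 : ∀ n {h : Fin n → ℤ} → (∀ j → h j ≡ 0ℤ) → sumFin n h ≡ 0ℤ
sumFin-0 zero eq = refl
sumFin-0 (suc n) eq rewrite eq F.zero | sumFin-0 n (λ j → eq (F.suc j)) = refl

sumFin-+ : ∀ n (h k : Fin n → ℤ) → sumFin n (λ j → h j + k j) ≡ sumFin n h + sumFin n k
sumFin-+ zero h k = refl
sumFin-+ (suc n) h k rewrite sumFin-+ n (λ j → h (F.suc j)) (λ j → k (F.suc j)) =
  interchange (h F.zero) (k F.zero) (sumFin n (λ j → h (F.suc j))) (sumFin n (λ j → k (F.suc j)))
  where interchange : ∀ a b c d → a + b + (c + d) ≡ a + c + (b + d)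
        interchange = solve-∀

sumFin-* : ∀ n c (h : Fin n → ℤ) → sumFin n (λ j → c * h j) ≡ c * sumFin n h
sumFin-* zero c h = sym (ℤP.*-zeroʳ c)
sumFin-* (suc n) c h rewrite sumFin-* n c (λ j → h (F.suc j)) = sym (ℤP.*-distribˡ-+ c _ _)

sumFin-neg : ∀ n (h : Fin n → ℤ) → sumFin n (λ j → - h j) ≡ - sumFin n h
sumFin-neg n h =
  trans (sumFin-ext n (λ j → sym (ℤP.-1*i≡-i (h j)))) (trans (sumFin-* n (- 1ℤ) h) (ℤP.-1*i≡-i _))

sumFin-swap : ∀ n m (h : Fin n → Fin m → ℤ) →
  sumFin n (λ i → sumFin m (λ j → h i j)) ≡ sumFin m (λ j → sumFin n (λ i → h i j))
sumFin-swap zero m h = sym (sumFin-0 m (λ j → refl))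
sumFin-swap (suc n) m h =
  trans (cong (_+_ (sumFin m (λ j → h F.zero j))) (sumFin-swap n m (λ i j → h (F.suc i) j)))
        (sym (sumFin-+ m (λ j → h F.zero j) (λ j → sumFin n (λ i → h (F.suc i) j))))

sumFin-last : ∀ k (h : Fin (suc k) → ℤ) → sumFin (suc k) h ≡ sumFin k (λ j → h (inject₁ j)) + h (fromℕ k)
sumFin-last zero h = trans (ℤP.+-identityʳ (h F.zero)) (sym (ℤP.+-identityˡ (h F.zero)))
sumFin-last (suc k) h = trans (cong (_+_ (h F.zero)) (sumFin-last k (λ j → h (F.suc j))))
  (sym (ℤP.+-assoc (h F.zero) (sumFin k (λ j → h (F.suc (inject₁ j)))) (h (F.suc (fromℕ k)))))

det-ext : ∀ n {A B : Mat n} → (∀ i j → A i j ≡ B i j) → det n A ≡ det n B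
det-ext zero eq = refl
det-ext (suc n) eq = sumFin-ext (suc n) (λ j → cong₂ (λ u v → sg j * (u * v)) (eq F.zero j)
  (det-ext n (λ i k → eq (F.suc i) (punchIn j k))))

minor₂ : ∀ {n} → Mat (suc (suc n)) → Fin (suc n) → Fin (suc n) → Mat n
minor₂ A i j r c = A (F.suc (punchIn i r)) (F.suc (punchIn j c))

-- Expanding along row 0 and then (using transpose invariance in smaller sizes) along
-- column 0 of each minor writes det A through the entries of row 0 and column 0.
expandRowCol : ∀ n (A : Mat (suc (suc n))) →
  (∀ B → det n (transpose B) ≡ det n B) → (∀ B → det (suc n) (transpose B) ≡ det (suc n) B) →
  det (suc (suc n)) A ≡ A F.zero F.zero * det (suc n) (λ i k → A (F.suc i) (F.suc k))
     + sumFin (suc n) (λ j → sumFin (suc n) (λ i →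
         - (sg j * sg i) * ((A F.zero (F.suc j) * A (F.suc i) F.zero) * det n (minor₂ A i j))))
expandRowCol n A detT₀ detT₁ =
  cong₂ _+_ (ℤP.*-identityˡ (A F.zero F.zero * det (suc n) (λ i k → A (F.suc i) (F.suc k))))
            (sumFin-ext (suc n) term)
  where
  open ≡-Reasoning
  a : Fin (suc n) → ℤ
  a j = A F.zero (F.suc j)
  b : Fin (suc n) → ℤ
  b i = A (F.suc i) F.zero
  reorder : ∀ x y z w e → (- x) * (y * (z * (w * e))) ≡ - (x * z) * ((y * w) * e)
  reorder = solve-∀
  term : ∀ j → sg (F.suc j) * (a j * det (suc n) (minor A (F.suc j)))
     ≡ sumFin (suc n) (λ i → - (sg j * sg i) * ((a j * b i) * det n (minor₂ A i j)))
  term j = begin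
      sg (F.suc j) * (a j * det (suc n) (minor A (F.suc j)))
    ≡⟨ cong (λ z → sg (F.suc j) * (a j * z)) (sym (detT₁ (minor A (F.suc j)))) ⟩
      sg (F.suc j) * (a j * sumFin (suc n) (λ i → sg i * (b i * det n (transpose (minor₂ A i j)))))
    ≡⟨ cong (λ z → sg (F.suc j) * (a j * z)) (sumFin-ext (suc n) (λ i →
         cong (λ z → sg i * (b i * z)) (detT₀ (minor₂ A i j)))) ⟩
      sg (F.suc j) * (a j * sumFin (suc n) (λ i → sg i * (b i * det n (minor₂ A i j))))
    ≡⟨ cong (sg (F.suc j) *_) (sym (sumFin-* (suc n) (a j) (λ i → sg i * (b i * det n (minor₂ A i j))))) ⟩
      sg (F.suc j) * sumFin (suc n) (λ i → a j * (sg i * (b i * det n (minor₂ A i j))))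
    ≡⟨ sym (sumFin-* (suc n) (sg (F.suc j)) (λ i → a j * (sg i * (b i * det n (minor₂ A i j))))) ⟩
      sumFin (suc n) (λ i → sg (F.suc j) * (a j * (sg i * (b i * det n (minor₂ A i j)))))
    ≡⟨ sumFin-ext (suc n) (λ i →
         trans (cong (λ z → z * (a j * (sg i * (b i * det n (minor₂ A i j))))) (sign-suc (toℕ j)))
               (reorder (sg j) (a j) (sg i) (b i) (det n (minor₂ A i j)))) ⟩
      sumFin (suc n) (λ i → - (sg j * sg i) * ((a j * b i) * det n (minor₂ A i j)))
    ∎

-- The determinant is invariant under transposition: the row/column expansion above is
-- symmetric in rows and columns.
detT : ∀ n A → det n (transpose A) ≡ det n A
detT zero A = refl
detT (suc zero) A = refl
detT (suc (suc n)) A = begin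
    det (suc (suc n)) (transpose A)
  ≡⟨ expandRowCol n (transpose A) (detT n) (detT (suc n)) ⟩
    A F.zero F.zero * det (suc n) (transpose A₁₁) + sumFin (suc n) (λ j → sumFin (suc n) (λ i → t j i))
  ≡⟨ cong₂ _+_ (cong (A F.zero F.zero *_) (detT (suc n) A₁₁))
       (trans (sumFin-swap (suc n) (suc n) t) (sumFin-ext (suc n) (λ j → sumFin-ext (suc n) (λ i →
          trans (cong (λ z → - (sg i * sg j) * ((A (F.suc i) F.zero * A F.zero (F.suc j)) * z)) (detT n (minor₂ A i j)))
                (swap (sg i) (sg j) (A (F.suc i) F.zero) (A F.zero (F.suc j)) (det n (minor₂ A i j))))))) ⟩
    A F.zero F.zero * det (suc n) A₁₁
     + sumFin (suc n) (λ j → sumFin (suc n) (λ i →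
         - (sg j * sg i) * ((A F.zero (F.suc j) * A (F.suc i) F.zero) * det n (minor₂ A i j))))
  ≡⟨ sym (expandRowCol n A (detT n) (detT (suc n))) ⟩
    det (suc (suc n)) A
  ∎
  where
  open ≡-Reasoning
  A₁₁ : Mat (suc n)
  A₁₁ i k = A (F.suc i) (F.suc k)
  t : Fin (suc n) → Fin (suc n) → ℤ
  t j i = - (sg j * sg i) * ((A (F.suc j) F.zero * A F.zero (F.suc i)) * det n (transpose (minor₂ A j i)))
  swap : ∀ x y z w e → - (x * y) * ((z * w) * e) ≡ - (y * x) * ((w * z) * e)
  swap = solve-∀

swapAdj : ∀ {n} → Fin n → Fin (suc n) → Fin (suc n)
swapAdj F.zero F.zero = F.suc F.zero
swapAdj F.zero (F.suc F.zero) = F.zero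
swapAdj F.zero (F.suc (F.suc k)) = F.suc (F.suc k)
swapAdj (F.suc c) F.zero = F.zero
swapAdj (F.suc c) (F.suc k) = F.suc (swapAdj c k)

swapAdj-invol : ∀ {n} (c : Fin n) j → swapAdj c (swapAdj c j) ≡ j
swapAdj-invol F.zero F.zero = refl
swapAdj-invol F.zero (F.suc F.zero) = refl
swapAdj-invol F.zero (F.suc (F.suc j)) = refl
swapAdj-invol (F.suc c) F.zero = refl
swapAdj-invol (F.suc c) (F.suc j) = cong F.suc (swapAdj-invol c j)

sumFin-swapAdj : ∀ n (c : Fin n) (h : Fin (suc n) → ℤ) → sumFin (suc n) (λ j → h (swapAdj c j)) ≡ sumFin (suc n) h
sumFin-swapAdj (suc n) F.zero h = exchange (h (F.suc F.zero)) (h F.zero) (sumFin n (λ j → h (F.suc (F.suc j))))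
  where exchange : ∀ a b c → a + (b + c) ≡ b + (a + c)
        exchange = solve-∀
sumFin-swapAdj (suc n) (F.suc c) h = cong (_+_ (h F.zero)) (sumFin-swapAdj n c (λ j → h (F.suc j)))

-- How a first-row column j sees the swap of columns c, c + 1: either j is one of the two
-- swapped columns (its sign flips and its minor is unchanged), or j is untouched and the
-- swap induces an adjacent swap c' inside the minor of j.
data SwapCase {m} (c : Fin (suc m)) (j : Fin (suc (suc m))) : Set where
  hit  : sg (swapAdj c j) ≡ - sg j → (∀ k → swapAdj c (punchIn (swapAdj c j) k) ≡ punchIn j k) → SwapCase c j
  miss : swapAdj c j ≡ j → (c' : Fin m) → (∀ k → swapAdj c (punchIn j k) ≡ punchIn j (swapAdj c' k)) → SwapCase c j

swapCase : ∀ {m} (c : Fin (suc m)) j → SwapCase c j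
swapCase F.zero F.zero = hit refl (λ { F.zero → refl ; (F.suc k) → refl })
swapCase F.zero (F.suc F.zero) = hit refl (λ { F.zero → refl ; (F.suc k) → refl })
swapCase {zero} F.zero (F.suc (F.suc ()))
swapCase {suc m} F.zero (F.suc (F.suc j)) =
  miss refl F.zero (λ { F.zero → refl ; (F.suc F.zero) → refl ; (F.suc (F.suc k)) → refl })
swapCase (F.suc c) F.zero = miss refl c (λ k → refl)
swapCase {zero} (F.suc ()) (F.suc j)
swapCase {suc m} (F.suc c) (F.suc j) with swapCase c j
... | hit s e = hit (trans (sign-suc (toℕ (swapAdj c j))) (trans (cong -_ s) (cong -_ (sym (sign-suc (toℕ j))))))
                    (λ { F.zero → refl ; (F.suc k) → cong F.suc (e k) })
... | miss e c' h = miss (cong F.suc e) (F.suc c') (λ { F.zero → refl ; (F.suc k) → cong F.suc (h k) })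

colSwap : ∀ m (c : Fin m) (A : Mat (suc m)) → det (suc m) (λ i j → A i (swapAdj c j)) ≡ - det (suc m) A
colSwap (suc m) c A = begin
    sumFin (suc (suc m)) h
  ≡⟨ sym (sumFin-swapAdj (suc m) c h) ⟩
    sumFin (suc (suc m)) (λ j → h (swapAdj c j))
  ≡⟨ sumFin-ext (suc (suc m)) (λ j → termwise j (swapCase c j)) ⟩
    sumFin (suc (suc m)) (λ j → - (sg j * (A F.zero j * det (suc m) (minor A j))))
  ≡⟨ sumFin-neg (suc (suc m)) (λ j → sg j * (A F.zero j * det (suc m) (minor A j))) ⟩
    - det (suc (suc m)) A
  ∎
  where
  open ≡-Reasoning
  h : Fin (suc (suc m)) → ℤ
  h j = sg j * (A F.zero (swapAdj c j) * det (suc m) (λ i k → A (F.suc i) (swapAdj c (punchIn j k))))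
  pullNeg : ∀ x y z → x * (y * - z) ≡ - (x * (y * z))
  pullNeg = solve-∀
  termwise : ∀ j → SwapCase c j → h (swapAdj c j) ≡ - (sg j * (A F.zero j * det (suc m) (minor A j)))
  termwise j (hit s e) = begin
      h (swapAdj c j)
    ≡⟨ cong₂ (λ u v → u * (A F.zero v * det (suc m) (λ i k → A (F.suc i) (swapAdj c (punchIn (swapAdj c j) k)))))
             s (swapAdj-invol c j) ⟩
      - sg j * (A F.zero j * det (suc m) (λ i k → A (F.suc i) (swapAdj c (punchIn (swapAdj c j) k))))
    ≡⟨ cong (λ z → - sg j * (A F.zero j * z)) (det-ext (suc m) (λ i k → cong (A (F.suc i)) (e k))) ⟩
      - sg j * (A F.zero j * det (suc m) (minor A j))
    ≡⟨ sym (ℤP.neg-distribˡ-* (sg j) (A F.zero j * det (suc m) (minor A j))) ⟩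
      - (sg j * (A F.zero j * det (suc m) (minor A j)))
    ∎
  termwise j (miss e c' e') = begin
      h (swapAdj c j)
    ≡⟨ cong h e ⟩
      sg j * (A F.zero (swapAdj c j) * det (suc m) (λ i k → A (F.suc i) (swapAdj c (punchIn j k))))
    ≡⟨ cong₂ (λ u v → sg j * (A F.zero u * v)) e (det-ext (suc m) (λ i k → cong (A (F.suc i)) (e' k))) ⟩
      sg j * (A F.zero j * det (suc m) (λ i k → minor A j i (swapAdj c' k)))
    ≡⟨ cong (λ z → sg j * (A F.zero j * z)) (colSwap m c' (minor A j)) ⟩
      sg j * (A F.zero j * - det (suc m) (minor A j))
    ≡⟨ pullNeg (sg j) (A F.zero j) (det (suc m) (minor A j)) ⟩
      - (sg j * (A F.zero j * det (suc m) (minor A j)))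
    ∎

self-neg⇒0 : ∀ x → x ≡ - x → x ≡ 0ℤ
self-neg⇒0 (+ zero) _ = refl
self-neg⇒0 (+ suc n) ()
self-neg⇒0 (ℤ.-[1+ n ]) ()

swapAdj-fix : ∀ {n} (c : Fin n) (v : Fin (suc n) → ℤ) → v (inject₁ c) ≡ v (F.suc c) → ∀ j → v (swapAdj c j) ≡ v j
swapAdj-fix F.zero v eq F.zero = sym eq
swapAdj-fix F.zero v eq (F.suc F.zero) = eq
swapAdj-fix F.zero v eq (F.suc (F.suc j)) = refl
swapAdj-fix (F.suc c) v eq F.zero = refl
swapAdj-fix (F.suc c) v eq (F.suc j) = swapAdj-fix c (λ k → v (F.suc k)) eq j

-- A matrix with two equal adjacent columns is singular (det = - det).
detEqualCols : ∀ m (c : Fin m) (B : Mat (suc m)) → (∀ i → B i (inject₁ c) ≡ B i (F.suc c)) → det (suc m) B ≡ 0ℤ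
detEqualCols m c B eq =
  self-neg⇒0 _ (trans (sym (det-ext (suc m) (λ i j → swapAdj-fix c (B i) (eq i) j))) (colSwap m c B))

colLin : ∀ n (c : Fin n) (A B C : Mat n) (t : ℤ) →
  (∀ i j → j ≢ c → A i j ≡ B i j) → (∀ i j → j ≢ c → A i j ≡ C i j) → (∀ i → A i c ≡ B i c + t * C i c) →
  det n A ≡ det n B + t * det n C
colLin (suc n) c A B C t eB eC ec = begin
    sumFin (suc n) (λ j → sg j * (A F.zero j * det n (minor A j)))
  ≡⟨ sumFin-ext (suc n) term ⟩
    sumFin (suc n) (λ j → sg j * (B F.zero j * det n (minor B j)) + t * (sg j * (C F.zero j * det n (minor C j))))
  ≡⟨ sumFin-+ (suc n) (λ j → sg j * (B F.zero j * det n (minor B j))) (λ j → t * (sg j * (C F.zero j * det n (minor C j)))) ⟩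
    det (suc n) B + sumFin (suc n) (λ j → t * (sg j * (C F.zero j * det n (minor C j))))
  ≡⟨ cong (_+_ (det (suc n) B)) (sumFin-* (suc n) t (λ j → sg j * (C F.zero j * det n (minor C j)))) ⟩
    det (suc n) B + t * det (suc n) C
  ∎
  where
  open ≡-Reasoning
  linˡ : ∀ s b c d t → s * ((b + t * c) * d) ≡ s * (b * d) + t * (s * (c * d))
  linˡ = solve-∀
  linʳ : ∀ s a db dc t → s * (a * (db + t * dc)) ≡ s * (a * db) + t * (s * (a * dc))
  linʳ = solve-∀
  term : ∀ j → sg j * (A F.zero j * det n (minor A j))
             ≡ sg j * (B F.zero j * det n (minor B j)) + t * (sg j * (C F.zero j * det n (minor C j)))
  term j with j FP.≟ c
  -- column c: the minors of A, B, C coincide and the first-row entry is linear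
  ... | yes refl =
    let mB = det-ext n {minor A j} {minor B j} (λ i k → eB (F.suc i) (punchIn j k) (FP.punchInᵢ≢i j k))
        mC = det-ext n {minor A j} {minor C j} (λ i k → eC (F.suc i) (punchIn j k) (FP.punchInᵢ≢i j k))
    in trans (cong (λ u → sg j * (u * det n (minor A j))) (ec F.zero))
       (trans (linˡ (sg j) (B F.zero j) (C F.zero j) (det n (minor A j)) t)
         (cong₂ (λ u v → sg j * (B F.zero j * u) + t * (sg j * (C F.zero j * v))) mB mC))
  -- another column: the first-row entries coincide and the minor is linear in column c'
  ... | no j≢c =
    let c' = F.punchOut j≢c
        pc : punchIn j c' ≡ c
        pc = FP.punchIn-punchOut j≢c
        avoid : ∀ k → k ≢ c' → punchIn j k ≢ c
        avoid k k≢ q = k≢ (FP.punchIn-injective j k c' (trans q (sym pc)))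
        ih = colLin n c' (minor A j) (minor B j) (minor C j) t
               (λ i k k≢ → eB (F.suc i) (punchIn j k) (avoid k k≢))
               (λ i k k≢ → eC (F.suc i) (punchIn j k) (avoid k k≢))
               (λ i → subst (λ z → A (F.suc i) z ≡ B (F.suc i) z + t * C (F.suc i) z) (sym pc) (ec (F.suc i)))
    in trans (cong (λ v → sg j * (A F.zero j * v)) ih)
        (trans (linʳ (sg j) (A F.zero j) (det n (minor B j)) (det n (minor C j)) t)
          (cong₂ (λ u v → sg j * (u * det n (minor B j)) + t * (sg j * (v * det n (minor C j))))
                 (eB F.zero j j≢c) (eC F.zero j j≢c)))

replaceAt : ∀ {n} (x : Fin n) (a : ℤ) (b : Fin n → ℤ) → Fin n → ℤ
replaceAt x a b j with j FP.≟ x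
... | yes _ = a
... | no _ = b j

replaceAt-here : ∀ {n} (x : Fin n) a b → replaceAt x a b x ≡ a
replaceAt-here x a b with x FP.≟ x
... | yes _ = refl
... | no ne = ⊥-elim (ne refl)

replaceAt-there : ∀ {n} (x : Fin n) a b j → j ≢ x → replaceAt x a b j ≡ b j
replaceAt-there x a b j ne with j FP.≟ x
... | yes e = ⊥-elim (ne e)
... | no _ = refl

-- Adding t times column y to column x does not change the determinant, provided matrices
-- with equal columns x and y are singular.  (By linearity the change is t times such a det.)
colAdd : ∀ n (x y : Fin n) → y ≢ x → (∀ C → (∀ i → C i x ≡ C i y) → det n C ≡ 0ℤ) →
  (A A' : Mat n) (t : ℤ) → (∀ i j → j ≢ x → A' i j ≡ A i j) → (∀ i → A' i x ≡ A i x + t * A i y) →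
  det n A' ≡ det n A
colAdd n x y y≢x singular A A' t e ex = begin
    det n A'
  ≡⟨ colLin n x A' A C t e (λ i j j≢x → trans (e i j j≢x) (sym (replaceAt-there x (A i y) (A i) j j≢x)))
       (λ i → trans (ex i) (cong (λ z → A i x + t * z) (sym (replaceAt-here x (A i y) (A i))))) ⟩
    det n A + t * det n C
  ≡⟨ cong (λ z → det n A + t * z) (singular C (λ i → trans (replaceAt-here x (A i y) (A i))
                                                          (sym (replaceAt-there x (A i y) (A i) y y≢x)))) ⟩
    det n A + t * 0ℤ
  ≡⟨ trans (cong (_+_ (det n A)) (ℤP.*-zeroʳ t)) (ℤP.+-identityʳ (det n A)) ⟩
    det n A
  ∎
  where
  open ≡-Reasoning
  C : Mat n
  C i = replaceAt x (A i y) (A i)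

inject₁≢suc : ∀ {m} (c : Fin m) → inject₁ c ≢ F.suc c
inject₁≢suc F.zero ()
inject₁≢suc (F.suc c) eq = inject₁≢suc c (FP.suc-injective eq)

colAddNext : ∀ m (c : Fin m) (A A' : Mat (suc m)) t →
  (∀ i j → j ≢ F.suc c → A' i j ≡ A i j) → (∀ i → A' i (F.suc c) ≡ A i (F.suc c) + t * A i (inject₁ c)) →
  det (suc m) A' ≡ det (suc m) A
colAddNext m c = colAdd (suc m) (F.suc c) (inject₁ c) (inject₁≢suc c) (λ C eq → detEqualCols m c C (λ i → sym (eq i)))

colAddPrev : ∀ m (c : Fin m) (A A' : Mat (suc m)) t →
  (∀ i j → j ≢ inject₁ c → A' i j ≡ A i j) → (∀ i → A' i (inject₁ c) ≡ A i (inject₁ c) + t * A i (F.suc c)) →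
  det (suc m) A' ≡ det (suc m) A
colAddPrev m c = colAdd (suc m) (inject₁ c) (F.suc c) (λ q → inject₁≢suc c (sym q)) (λ C eq → detEqualCols m c C eq)

rowAddPrev : ∀ m (c : Fin m) (A A' : Mat (suc m)) t →
  (∀ i j → i ≢ inject₁ c → A' i j ≡ A i j) → (∀ j → A' (inject₁ c) j ≡ A (inject₁ c) j + t * A (F.suc c) j) →
  det (suc m) A' ≡ det (suc m) A
rowAddPrev m c A A' t e ex =
  trans (sym (detT (suc m) A'))
        (trans (colAddPrev m c (transpose A) (transpose A') t (λ i j ne → e j i ne) ex) (detT (suc m) A))

punchIn-fromℕ : ∀ n (k : Fin n) → punchIn (fromℕ n) k ≡ inject₁ k
punchIn-fromℕ (suc n) F.zero = refl
punchIn-fromℕ (suc n) (F.suc k) = cong F.suc (punchIn-fromℕ n k)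

punchIn-inject₁-fromℕ : ∀ n (j : Fin (suc n)) → punchIn (inject₁ j) (fromℕ n) ≡ fromℕ (suc n)
punchIn-inject₁-fromℕ n F.zero = refl
punchIn-inject₁-fromℕ (suc n) (F.suc j) = cong F.suc (punchIn-inject₁-fromℕ n j)

punchIn-inject₁ : ∀ {n} (j : Fin (suc n)) (k : Fin n) → punchIn (inject₁ j) (inject₁ k) ≡ inject₁ (punchIn j k)
punchIn-inject₁ F.zero k = refl
punchIn-inject₁ (F.suc j) F.zero = refl
punchIn-inject₁ (F.suc j) (F.suc k) = cong F.suc (punchIn-inject₁ j k)

-- Induction: in the first-row expansion the last column's minor has a zero last row, and
-- every other minor again has last row (0, …, 0, c).
lastRow : ∀ n (A : Mat (suc n)) c → A (fromℕ n) (fromℕ n) ≡ c → (∀ j → A (fromℕ n) (inject₁ j) ≡ 0ℤ) →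
  det (suc n) A ≡ c * det n (λ i j → A (inject₁ i) (inject₁ j))
lastRow zero A c e0 ez = trans (ℤP.+-identityʳ (1ℤ * (A F.zero F.zero * 1ℤ)))
  (trans (ℤP.*-identityˡ (A F.zero F.zero * 1ℤ)) (cong (_* 1ℤ) e0))
lastRow (suc n) A c e0 ez = begin
    det (suc (suc n)) A
  ≡⟨ sumFin-last (suc n) (λ j → sg j * (A F.zero j * det (suc n) (minor A j))) ⟩
    sumFin (suc n) (λ j → sg (inject₁ j) * (A F.zero (inject₁ j) * det (suc n) (minor A (inject₁ j))))
      + sg ℓ * (A F.zero ℓ * det (suc n) (minor A ℓ))
  ≡⟨ cong₂ _+_ (sumFin-ext (suc n) inner) lastTerm ⟩
    sumFin (suc n) (λ j → c * (sg j * (B F.zero j * det n (minor B j)))) + 0ℤ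
  ≡⟨ trans (ℤP.+-identityʳ _) (sumFin-* (suc n) c (λ j → sg j * (B F.zero j * det n (minor B j)))) ⟩
    c * det (suc n) B
  ∎
  where
  open ≡-Reasoning
  ℓ : Fin (suc (suc n))
  ℓ = fromℕ (suc n)
  B : Mat (suc n)
  B i j = A (inject₁ i) (inject₁ j)
  lastMinor : det (suc n) (minor A ℓ) ≡ 0ℤ
  lastMinor = trans (lastRow n (minor A ℓ) 0ℤ
      (trans (cong (A ℓ) (punchIn-fromℕ (suc n) (fromℕ n))) (ez (fromℕ n)))
      (λ j → trans (cong (A ℓ) (punchIn-fromℕ (suc n) (inject₁ j))) (ez (inject₁ j))))
    (ℤP.*-zeroˡ (det n (λ i j → minor A ℓ (inject₁ i) (inject₁ j))))
  lastTerm : sg ℓ * (A F.zero ℓ * det (suc n) (minor A ℓ)) ≡ 0ℤ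
  lastTerm = trans (cong (λ z → sg ℓ * (A F.zero ℓ * z)) lastMinor)
    (trans (cong (sg ℓ *_) (ℤP.*-zeroʳ (A F.zero ℓ))) (ℤP.*-zeroʳ (sg ℓ)))
  reorder : ∀ a b c d → a * (b * (c * d)) ≡ c * (a * (b * d))
  reorder = solve-∀
  inner : ∀ j → sg (inject₁ j) * (A F.zero (inject₁ j) * det (suc n) (minor A (inject₁ j)))
              ≡ c * (sg j * (B F.zero j * det n (minor B j)))
  inner j = begin
      sg (inject₁ j) * (A F.zero (inject₁ j) * det (suc n) (minor A (inject₁ j)))
    ≡⟨ cong₂ (λ u v → sign u * (B F.zero j * v)) (FP.toℕ-inject₁ j)
         (lastRow n (minor A (inject₁ j)) c
           (trans (cong (A ℓ) (punchIn-inject₁-fromℕ n j)) e0)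
           (λ k → trans (cong (A ℓ) (punchIn-inject₁ j k)) (ez (punchIn j k)))) ⟩
      sg j * (B F.zero j * (c * det n (λ i k → A (F.suc (inject₁ i)) (punchIn (inject₁ j) (inject₁ k)))))
    ≡⟨ cong (λ z → sg j * (B F.zero j * (c * z))) (det-ext n (λ i k → cong (A (F.suc (inject₁ i))) (punchIn-inject₁ j k))) ⟩
      sg j * (B F.zero j * (c * det n (minor B j)))
    ≡⟨ reorder (sg j) (B F.zero j) c (det n (minor B j)) ⟩
      c * (sg j * (B F.zero j * det n (minor B j)))
    ∎

T⇒true : ∀ {b} → T b → b ≡ true
T⇒true {true} _ = refl

¬T⇒false : ∀ {b} → ¬ T b → b ≡ false
¬T⇒false {true} n = ⊥-elim (n tt)
¬T⇒false {false} _ = refl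

≤ᵇ-true : ∀ {m n} → m ≤ n → (m ≤ᵇ n) ≡ true
≤ᵇ-true p = T⇒true (NP.≤⇒≤ᵇ p)

≤ᵇ-false : ∀ {m n} → ¬ m ≤ n → (m ≤ᵇ n) ≡ false
≤ᵇ-false {m} {n} p = ¬T⇒false (λ t → p (NP.≤ᵇ⇒≤ m n t))

<ᵇ-true : ∀ {m n} → m < n → (m <ᵇ n) ≡ true
<ᵇ-true p = T⇒true (NP.<⇒<ᵇ p)

<ᵇ-false : ∀ {m n} → ¬ m < n → (m <ᵇ n) ≡ false
<ᵇ-false {m} {n} p = ¬T⇒false (λ t → p (NP.<ᵇ⇒< m n t))

splitAt : ∀ i (P : ℕ → Set) → (∀ j → j < i → P j) → (∀ e → P (i ℕ.+ e)) → ∀ j → P j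
splitAt i P lo hi j with j NP.<? i
... | yes j<i = lo j j<i
... | no j≮i = subst P (NP.m+[n∸m]≡n (NP.≮⇒≥ j≮i)) (hi (j ∸ i))

-- The Sylvester matrix for prescribed degrees m, n and coefficient functions F, G;
-- sylvesterEntry f g is its instance for deg f, deg g, coeff f, coeff g.
sylvesterGen : ℕ → ℕ → (ℕ → ℤ) → (ℕ → ℤ) → ℕ → ℕ → ℤ
sylvesterGen m n F G i j =
  if i <ᵇ n
  then (if (i ≤ᵇ j) ∧ (j ≤ᵇ i ℕ.+ m) then F (i ℕ.+ m ∸ j) else 0ℤ)
  else (if ((i ∸ n) ≤ᵇ j) ∧ (j ≤ᵇ (i ∸ n) ℕ.+ n)
        then G ((i ∸ n) ℕ.+ n ∸ j) else 0ℤ)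

matOf : ∀ N → (ℕ → ℕ → ℤ) → Mat N
matOf N E i j = E (toℕ i) (toℕ j)

revCoeff : ℕ → (ℕ → ℤ) → ℕ → ℤ
revCoeff m F e = if e ≤ᵇ m then F (m ∸ e) else 0ℤ

revCoeff-≤ : ∀ m F e d → e ℕ.+ d ≡ m → revCoeff m F e ≡ F d
revCoeff-≤ m F e d eq rewrite ≤ᵇ-true {e} {m} (subst (e ≤_) eq (NP.m≤m+n e d)) =
  cong F (trans (cong (_∸ e) (sym eq)) (NP.m+n∸m≡n e d))

revCoeff-> : ∀ m F e → m < e → revCoeff m F e ≡ 0ℤ
revCoeff-> m F e m<e rewrite ≤ᵇ-false {e} {m} (NP.<⇒≱ m<e) = refl

shiftRow : ℕ → (ℕ → ℤ) → ℕ → ℤ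
shiftRow zero R j = R j
shiftRow (suc u) R zero = 0ℤ
shiftRow (suc u) R (suc j) = shiftRow u R j

shiftRow-< : ∀ u R j → j < u → shiftRow u R j ≡ 0ℤ
shiftRow-< (suc u) R zero _ = refl
shiftRow-< (suc u) R (suc j) (s≤s p) = shiftRow-< u R j p

shiftRow-+ : ∀ u R e → shiftRow u R (u ℕ.+ e) ≡ R e
shiftRow-+ zero R e = refl
shiftRow-+ (suc u) R e = shiftRow-+ u R e

shiftRow-ext : ∀ u {R R'} → (∀ e → R e ≡ R' e) → ∀ j → shiftRow u R j ≡ shiftRow u R' j
shiftRow-ext zero eq j = eq j
shiftRow-ext (suc u) eq zero = refl
shiftRow-ext (suc u) eq (suc j) = shiftRow-ext u eq j

≤ᵇ-+ : ∀ i e m → (i ℕ.+ e ≤ᵇ i ℕ.+ m) ≡ (e ≤ᵇ m)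
≤ᵇ-+ i e m with e NP.≤? m
... | yes p = trans (≤ᵇ-true (NP.+-monoʳ-≤ i p)) (sym (≤ᵇ-true p))
... | no p = trans (≤ᵇ-false (λ q → p (NP.+-cancelˡ-≤ i e m q))) (sym (≤ᵇ-false p))

shiftedBand : ∀ m F i j →
  (if (i ≤ᵇ j) ∧ (j ≤ᵇ i ℕ.+ m) then F (i ℕ.+ m ∸ j) else 0ℤ) ≡ shiftRow i (revCoeff m F) j
shiftedBand m F i = splitAt i _ lo hi
  where
  lo : ∀ j → j < i → (if (i ≤ᵇ j) ∧ (j ≤ᵇ i ℕ.+ m) then F (i ℕ.+ m ∸ j) else 0ℤ) ≡ shiftRow i (revCoeff m F) j
  lo j j<i rewrite ≤ᵇ-false {i} {j} (NP.<⇒≱ j<i) = sym (shiftRow-< i (revCoeff m F) j j<i)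
  hi : ∀ e → (if (i ≤ᵇ i ℕ.+ e) ∧ (i ℕ.+ e ≤ᵇ i ℕ.+ m) then F (i ℕ.+ m ∸ (i ℕ.+ e)) else 0ℤ) ≡ shiftRow i (revCoeff m F) (i ℕ.+ e)
  hi e rewrite ≤ᵇ-true {i} {i ℕ.+ e} (NP.m≤m+n i e) | ≤ᵇ-+ i e m | NP.[m+n]∸[m+o]≡n∸o i m e | shiftRow-+ i (revCoeff m F) e = refl

sylvester-fRow : ∀ m n F G i j → i < n → sylvesterGen m n F G i j ≡ shiftRow i (revCoeff m F) j
sylvester-fRow m n F G i j i<n rewrite <ᵇ-true i<n = shiftedBand m F i j

sylvester-gRow : ∀ m n F G i j → ¬ i < n → sylvesterGen m n F G i j ≡ shiftRow (i ∸ n) (revCoeff n G) j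
sylvester-gRow m n F G i j i≮n rewrite <ᵇ-false i≮n = shiftedBand n G (i ∸ n) j

-- horner a R j = R j + a R (j-1) + … + a^j R 0: the result of successively adding a times
-- column j - 1 to column j for j = 1, 2, …  On a reversed coefficient row of g, horner a R (deg g) = g(a).
horner : ℤ → (ℕ → ℤ) → ℕ → ℤ
horner a R zero = R zero
horner a R (suc j) = R (suc j) + a * horner a R j

horner-ext : ∀ a {R R'} → (∀ e → R e ≡ R' e) → ∀ j → horner a R j ≡ horner a R' j
horner-ext a eq zero = eq zero
horner-ext a eq (suc j) = cong₂ (λ u v → u + a * v) (eq (suc j)) (horner-ext a eq j)

shiftRow-horner-step : ∀ a R u j → shiftRow u R j + a * shiftRow (suc u) (horner a R) j ≡ shiftRow u (horner a R) j
shiftRow-horner-step a R zero zero = trans (cong (λ z → R zero + z) (ℤP.*-zeroʳ a)) (ℤP.+-identityʳ (R zero))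
shiftRow-horner-step a R (suc u) zero = cong (λ z → 0ℤ + z) (ℤP.*-zeroʳ a)
shiftRow-horner-step a R zero (suc j) = refl
shiftRow-horner-step a R (suc u) (suc j) = shiftRow-horner-step a R u j

horner-shiftRow : ∀ a R u j → horner a (shiftRow u R) j ≡ shiftRow u (horner a R) j
horner-shiftRow a R zero zero = refl
horner-shiftRow a R (suc u) zero = refl
horner-shiftRow a R u (suc j) = trans (cong (λ z → shiftRow u R (suc j) + a * z) (horner-shiftRow a R u j)) (step u)
  where
  step : ∀ u → shiftRow u R (suc j) + a * shiftRow u (horner a R) j ≡ shiftRow u (horner a R) (suc j)
  step zero = refl
  step (suc u) = shiftRow-horner-step a R u j

shiftRow-horner-diff : ∀ a R u j → shiftRow u (horner a R) j - a * shiftRow (suc u) (horner a R) j ≡ shiftRow u R j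
shiftRow-horner-diff a R zero zero = trans (cong (λ z → R zero - z) (ℤP.*-zeroʳ a)) (ℤP.+-identityʳ (R zero))
shiftRow-horner-diff a R zero (suc j) = cancel (R (suc j)) a (horner a R j)
  where cancel : ∀ x a y → x + a * y - a * y ≡ x
        cancel = solve-∀
shiftRow-horner-diff a R (suc u) zero = cong (λ z → 0ℤ - z) (ℤP.*-zeroʳ a)
shiftRow-horner-diff a R (suc u) (suc j) = shiftRow-horner-diff a R u j

shiftRow-≥ : ∀ u R j → u ≤ j → shiftRow u R j ≡ R (j ∸ u)
shiftRow-≥ u R j u≤j = subst (λ z → shiftRow u R z ≡ R (z ∸ u)) (NP.m+[n∸m]≡n u≤j)
  (trans (shiftRow-+ u R (j ∸ u)) (cong R (sym (NP.m+n∸m≡n u (j ∸ u)))))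

-- If F is the coefficient sequence of (x - a)·f₁ with deg f₁ ≤ m1, then Horner accumulation turns
-- the reversed row of F into the reversed row of f₁ (with one trailing zero).
module HornerFactor (m1 : ℕ) (F F1 : ℕ → ℤ) (a : ℤ)
  (hF0 : F 0 ≡ - (a * F1 0)) (hF : ∀ k → F (suc k) ≡ F1 k - a * F1 (suc k)) (hF1 : ∀ k → m1 < k → F1 k ≡ 0ℤ) where

  open ≡-Reasoning

  revCoeff-top : revCoeff (suc m1) F 0 ≡ revCoeff m1 F1 0
  revCoeff-top = begin
      revCoeff (suc m1) F 0
    ≡⟨ revCoeff-≤ (suc m1) F 0 (suc m1) refl ⟩
      F (suc m1)
    ≡⟨ hF m1 ⟩
      F1 m1 - a * F1 (suc m1)
    ≡⟨ cong (λ z → F1 m1 - a * z) (hF1 (suc m1) (NP.n<1+n m1)) ⟩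
      F1 m1 - a * 0ℤ
    ≡⟨ trans (cong (_-_ (F1 m1)) (ℤP.*-zeroʳ a)) (ℤP.+-identityʳ (F1 m1)) ⟩
      F1 m1
    ≡⟨ sym (revCoeff-≤ m1 F1 0 m1 refl) ⟩
      revCoeff m1 F1 0
    ∎

  revCoeff-step : ∀ e → revCoeff (suc m1) F (suc e) + a * revCoeff m1 F1 e ≡ revCoeff m1 F1 (suc e)
  revCoeff-step e with NP.<-cmp e m1
  ... | tri< e<m1 _ _ = begin
      revCoeff (suc m1) F (suc e) + a * revCoeff m1 F1 e
    ≡⟨ cong₂ (λ u v → u + a * v) (revCoeff-≤ (suc m1) F (suc e) (suc d) (cong suc (trans (NP.+-suc e d) e+d)))
                                 (revCoeff-≤ m1 F1 e (suc d) (trans (NP.+-suc e d) e+d)) ⟩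
      F (suc d) + a * F1 (suc d)
    ≡⟨ cong (_+ a * F1 (suc d)) (hF d) ⟩
      F1 d - a * F1 (suc d) + a * F1 (suc d)
    ≡⟨ cancel (F1 d) a (F1 (suc d)) ⟩
      F1 d
    ≡⟨ sym (revCoeff-≤ m1 F1 (suc e) d e+d) ⟩
      revCoeff m1 F1 (suc e)
    ∎
    where
    d = m1 ∸ suc e
    e+d : suc e ℕ.+ d ≡ m1
    e+d = NP.m+[n∸m]≡n e<m1
    cancel : ∀ x a y → x - a * y + a * y ≡ x
    cancel = solve-∀
  ... | tri≈ _ refl _ = begin
      revCoeff (suc e) F (suc e) + a * revCoeff e F1 e
    ≡⟨ cong₂ (λ u v → u + a * v) (revCoeff-≤ (suc e) F (suc e) 0 (NP.+-identityʳ (suc e))) (revCoeff-≤ e F1 e 0 (NP.+-identityʳ e)) ⟩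
      F 0 + a * F1 0
    ≡⟨ cong (_+ a * F1 0) hF0 ⟩
      - (a * F1 0) + a * F1 0
    ≡⟨ ℤP.+-inverseˡ (a * F1 0) ⟩
      0ℤ
    ≡⟨ sym (revCoeff-> e F1 (suc e) (NP.n<1+n e)) ⟩
      revCoeff e F1 (suc e)
    ∎
  ... | tri> _ _ m1<e = begin
      revCoeff (suc m1) F (suc e) + a * revCoeff m1 F1 e
    ≡⟨ cong₂ (λ u v → u + a * v) (revCoeff-> (suc m1) F (suc e) (s≤s m1<e)) (revCoeff-> m1 F1 e m1<e) ⟩
      0ℤ + a * 0ℤ
    ≡⟨ cong (_+_ 0ℤ) (ℤP.*-zeroʳ a) ⟩
      0ℤ
    ≡⟨ sym (revCoeff-> m1 F1 (suc e) (NP.m<n⇒m<1+n m1<e)) ⟩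
      revCoeff m1 F1 (suc e)
    ∎

  horner-revCoeff : ∀ e → horner a (revCoeff (suc m1) F) e ≡ revCoeff m1 F1 e
  horner-revCoeff zero = revCoeff-top
  horner-revCoeff (suc e) = trans (cong (λ z → revCoeff (suc m1) F (suc e) + a * z) (horner-revCoeff e)) (revCoeff-step e)

-- The key reduction:  Res((x - a)·f₁, g) = g(a)·Res(f₁, g).  On the Sylvester matrix of
-- F = (x - a)·f₁ (size N + 1, N = deg f₁ + deg g):
--  • column stage: column j += a · column (j-1), for j = 1, …, N.  The f-rows become the
--    f₁-rows (shifted), the g-rows become Horner accumulations of g;
--  • row stage: row i -= a · row (i+1) for the g-rows i = n, …, n + m1 - 1, restoring g;
--  • the last column is now (0, …, 0, g(a)), and the remaining N × N block is the Sylvester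
--    matrix of f₁ and g.
module LinearFactor (m1 n : ℕ) (F F1 G : ℕ → ℤ) (a : ℤ)
  (hF0 : F 0 ≡ - (a * F1 0)) (hF : ∀ k → F (suc k) ≡ F1 k - a * F1 (suc k)) (hF1 : ∀ k → m1 < k → F1 k ≡ 0ℤ) where

  open HornerFactor m1 F F1 a hF0 hF hF1

  N : ℕ
  N = m1 ℕ.+ n

  Syl : ℕ → ℕ → ℤ
  Syl = sylvesterGen (suc m1) n F G

  gRev : ℕ → ℤ
  gRev = revCoeff n G

  gHorner : ℕ → ℤ
  gHorner = horner a gRev

  Hcol : ℕ → ℕ → ℤ
  Hcol i j = horner a (Syl i) j

  Hcol-f : ∀ i → i < n → ∀ j → Hcol i j ≡ shiftRow i (revCoeff m1 F1) j
  Hcol-f i i<n j = trans (horner-ext a (λ e → sylvester-fRow (suc m1) n F G i e i<n) j)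
    (trans (horner-shiftRow a (revCoeff (suc m1) F) i j) (shiftRow-ext i horner-revCoeff j))

  Hcol-g : ∀ i → ¬ i < n → ∀ j → Hcol i j ≡ shiftRow (i ∸ n) gHorner j
  Hcol-g i i≮n j = trans (horner-ext a (λ e → sylvester-gRow (suc m1) n F G i e i≮n) j) (horner-shiftRow a gRev (i ∸ n) j)

  ColsDone : ℕ → ℕ → ℕ → ℤ
  ColsDone t i j = if j ≤ᵇ t then Hcol i j else Syl i j

  ColsDone-other : ∀ t i j → j ≢ suc t → ColsDone (suc t) i j ≡ ColsDone t i j
  ColsDone-other t i j ne with j NP.≤? t
  ... | yes j≤t rewrite ≤ᵇ-true j≤t | ≤ᵇ-true (NP.m≤n⇒m≤1+n j≤t) = refl
  ... | no j≰t rewrite ≤ᵇ-false j≰t | ≤ᵇ-false {j} {suc t} (λ q → ne (NP.≤-antisym q (NP.≰⇒> j≰t))) = refl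

  ColsDone-col : ∀ t i → ColsDone (suc t) i (suc t) ≡ ColsDone t i (suc t) + a * ColsDone t i t
  ColsDone-col t i rewrite ≤ᵇ-true (NP.≤-refl {suc t}) | ≤ᵇ-false {suc t} {t} (NP.n≮n t) | ≤ᵇ-true (NP.≤-refl {t}) = refl

  colStep : ∀ (c : Fin N) → det (suc N) (matOf (suc N) (ColsDone (suc (toℕ c)))) ≡ det (suc N) (matOf (suc N) (ColsDone (toℕ c)))
  colStep c = colAddNext N c (matOf (suc N) (ColsDone (toℕ c))) (matOf (suc N) (ColsDone (suc (toℕ c)))) a
    (λ i j ne → ColsDone-other (toℕ c) (toℕ i) (toℕ j) (λ q → ne (FP.toℕ-injective q)))
    (λ i → trans (ColsDone-col (toℕ c) (toℕ i)) (cong (λ z → ColsDone (toℕ c) (toℕ i) (suc (toℕ c)) + a * ColsDone (toℕ c) (toℕ i) z) (sym (FP.toℕ-inject₁ c))))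

  colStage : ∀ t → t < suc N → det (suc N) (matOf (suc N) (ColsDone t)) ≡ det (suc N) (matOf (suc N) Syl)
  colStage zero _ = det-ext (suc N) (λ i j → none (toℕ i) (toℕ j))
    where none : ∀ i j → ColsDone 0 i j ≡ Syl i j
          none i zero = refl
          none i (suc j) = refl
  colStage (suc t) (s≤s t<N) =
    let c = fromℕ< t<N
        eq = FP.toℕ-fromℕ< t<N
    in trans (cong (λ z → det (suc N) (matOf (suc N) (ColsDone (suc z)))) (sym eq))
        (trans (colStep c) (trans (cong (λ z → det (suc N) (matOf (suc N) (ColsDone z))) eq) (colStage t (NP.m<n⇒m<1+n t<N))))

  colFinal : det (suc N) (matOf (suc N) Syl) ≡ det (suc N) (matOf (suc N) Hcol)
  colFinal = trans (sym (colStage N (NP.n<1+n N))) (det-ext (suc N) (λ i j → all (toℕ i) (toℕ j) (FP.toℕ≤pred[n] j)))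
    where all : ∀ i j → j ≤ N → ColsDone N i j ≡ Hcol i j
          all i j j≤ rewrite ≤ᵇ-true j≤ = refl

  rowReduced : ℕ → ℕ → Bool
  rowReduced t i = (n ≤ᵇ i) ∧ (i <ᵇ n ℕ.+ t)

  RowsDone : ℕ → ℕ → ℕ → ℤ
  RowsDone t i j = if rowReduced t i then Hcol i j - a * Hcol (suc i) j else Hcol i j

  rowReduced-other : ∀ t i → i ≢ n ℕ.+ t → rowReduced (suc t) i ≡ rowReduced t i
  rowReduced-other t i ne with n NP.≤? i
  ... | no n≰i rewrite ≤ᵇ-false n≰i = refl
  ... | yes n≤i rewrite ≤ᵇ-true n≤i with i NP.<? n ℕ.+ t
  ...   | yes lt rewrite <ᵇ-true lt | <ᵇ-true (NP.<-≤-trans lt (NP.+-monoʳ-≤ n (NP.n≤1+n t))) = refl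
  ...   | no nlt rewrite <ᵇ-false nlt =
          <ᵇ-false (λ q → ne (NP.≤-antisym (NP.≤-pred (subst (i ℕ.<_) (NP.+-suc n t) q)) (NP.≮⇒≥ nlt)))

  rowReduced-0 : ∀ i → rowReduced 0 i ≡ false
  rowReduced-0 i with n NP.≤? i
  ... | no n≰i rewrite ≤ᵇ-false n≰i = refl
  ... | yes n≤i rewrite ≤ᵇ-true n≤i = <ᵇ-false (λ q → NP.<⇒≱ (subst (i ℕ.<_) (NP.+-identityʳ n) q) n≤i)

  RowsDone-row : ∀ t j → RowsDone (suc t) (n ℕ.+ t) j ≡ RowsDone t (n ℕ.+ t) j + (- a) * RowsDone t (suc (n ℕ.+ t)) j
  RowsDone-row t j rewrite ≤ᵇ-true (NP.m≤m+n n t) | ≤ᵇ-true (NP.m≤n⇒m≤1+n (NP.m≤m+n n t))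
     | <ᵇ-true {n ℕ.+ t} {n ℕ.+ suc t} (subst (n ℕ.+ t ℕ.<_) (sym (NP.+-suc n t)) (NP.n<1+n (n ℕ.+ t)))
     | <ᵇ-false {n ℕ.+ t} {n ℕ.+ t} (NP.n≮n (n ℕ.+ t))
     | <ᵇ-false {suc (n ℕ.+ t)} {n ℕ.+ t} (λ q → NP.n≮n (n ℕ.+ t) (NP.<-trans (NP.n<1+n (n ℕ.+ t)) q)) =
     sub (Hcol (n ℕ.+ t) j) a (Hcol (suc (n ℕ.+ t)) j)
    where sub : ∀ x a y → x - a * y ≡ x + (- a) * y
          sub = solve-∀

  rowStep : ∀ t (c : Fin N) → toℕ c ≡ n ℕ.+ t →
    det (suc N) (matOf (suc N) (RowsDone (suc t))) ≡ det (suc N) (matOf (suc N) (RowsDone t))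
  rowStep t c eq = rowAddPrev N c (matOf (suc N) (RowsDone t)) (matOf (suc N) (RowsDone (suc t))) (- a)
    (λ i j ne → cong (λ b → if b then Hcol (toℕ i) (toℕ j) - a * Hcol (suc (toℕ i)) (toℕ j) else Hcol (toℕ i) (toℕ j))
       (rowReduced-other t (toℕ i) (λ q → ne (FP.toℕ-injective (trans q (sym (trans (FP.toℕ-inject₁ c) eq)))))))
    (λ j → subst₂ (λ r s → RowsDone (suc t) r (toℕ j) ≡ RowsDone t r (toℕ j) + (- a) * RowsDone t s (toℕ j))
        (sym (trans (FP.toℕ-inject₁ c) eq)) (cong suc (sym eq)) (RowsDone-row t (toℕ j)))

  rowStage : ∀ t → t ≤ m1 → det (suc N) (matOf (suc N) (RowsDone t)) ≡ det (suc N) (matOf (suc N) Hcol)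
  rowStage zero _ = det-ext (suc N) (λ i j → cong (λ b → if b then Hcol (toℕ i) (toℕ j) - a * Hcol (suc (toℕ i)) (toℕ j) else Hcol (toℕ i) (toℕ j)) (rowReduced-0 (toℕ i)))
  rowStage (suc t) t<m1 =
    let p : n ℕ.+ t < N
        p = subst (n ℕ.+ t ℕ.<_) (NP.+-comm n m1) (NP.+-monoʳ-< n t<m1)
    in trans (rowStep t (fromℕ< p) (FP.toℕ-fromℕ< p)) (rowStage t (NP.<⇒≤ t<m1))

  Final : ℕ → ℕ → ℤ
  Final = RowsDone m1

  Final-f : ∀ i j → i < n → Final i j ≡ shiftRow i (revCoeff m1 F1) j
  Final-f i j i<n rewrite ≤ᵇ-false {n} {i} (NP.<⇒≱ i<n) = Hcol-f i i<n j

  Final-g : ∀ i j → n ≤ i → i < n ℕ.+ m1 → Final i j ≡ shiftRow (i ∸ n) gRev j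
  Final-g i j n≤i lt rewrite ≤ᵇ-true n≤i | <ᵇ-true lt =
    trans (cong₂ (λ u v → u - a * v) (Hcol-g i (NP.≤⇒≯ n≤i) j)
       (trans (Hcol-g (suc i) (λ q → NP.≤⇒≯ n≤i (NP.<-trans (NP.n<1+n i) q)) j) (cong (λ z → shiftRow z gHorner j) (NP.+-∸-assoc 1 n≤i))))
     (shiftRow-horner-diff a gRev (i ∸ n) j)

  Final-last : ∀ j → Final N j ≡ shiftRow m1 gHorner j
  Final-last j rewrite ≤ᵇ-true {n} {N} (NP.m≤n+m n m1) | <ᵇ-false {N} {n ℕ.+ m1} (λ q → NP.n≮n N (subst (N ℕ.<_) (NP.+-comm n m1) q)) =
    trans (Hcol-g N (λ q → NP.n≮n n (NP.≤-<-trans (NP.m≤n+m n m1) q)) j) (cong (λ z → shiftRow z gHorner j) (NP.m+n∸n≡m m1 n))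

  Final-corner : Final N N ≡ gHorner n
  Final-corner = trans (Final-last N) (shiftRow-+ m1 gHorner n)

  Final-lastCol : ∀ i → i < N → Final i N ≡ 0ℤ
  Final-lastCol i i<N with i NP.<? n
  ... | yes i<n = trans (Final-f i N i<n) (trans (shiftRow-≥ i (revCoeff m1 F1) N (NP.<⇒≤ i<N))
        (revCoeff-> m1 F1 (N ∸ i) (subst (m1 ℕ.<_) (sym (NP.+-∸-assoc m1 (NP.<⇒≤ i<n))) (NP.m<m+n m1 (NP.m<n⇒0<n∸m i<n)))))
  ... | no i≮n =
    let n≤i = NP.≮⇒≥ i≮n
        u = i ∸ n
        u<m1 : u < m1
        u<m1 = subst (u ℕ.<_) (NP.m+n∸n≡m m1 n) (NP.∸-monoˡ-< i<N n≤i)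
    in trans (Final-g i N n≤i (subst (i ℕ.<_) (NP.+-comm m1 n) i<N))
        (trans (shiftRow-≥ u gRev N (NP.≤-trans (NP.<⇒≤ u<m1) (NP.m≤m+n m1 n)))
          (revCoeff-> n G (N ∸ u) (subst (n ℕ.<_) (sym (NP.+-∸-comm n (NP.<⇒≤ u<m1))) (NP.m<n+m n (NP.m<n⇒0<n∸m u<m1)))))

  Final-top : ∀ i j → i < N → Final i j ≡ sylvesterGen m1 n F1 G i j
  Final-top i j i<N with i NP.<? n
  ... | yes i<n = trans (Final-f i j i<n) (sym (sylvester-fRow m1 n F1 G i j i<n))
  ... | no i≮n = trans (Final-g i j (NP.≮⇒≥ i≮n) (subst (i ℕ.<_) (NP.+-comm m1 n) i<N)) (sym (sylvester-gRow m1 n F1 G i j i≮n))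

  -- det Syl = g(a) · det Sylvester(f₁, g), expanding the transposed final matrix along its last row
  det-linearFactor : det (suc N) (matOf (suc N) Syl) ≡ gHorner n * det N (matOf N (sylvesterGen m1 n F1 G))
  det-linearFactor = begin
      det (suc N) (matOf (suc N) Syl)
    ≡⟨ colFinal ⟩
      det (suc N) (matOf (suc N) Hcol)
    ≡⟨ sym (rowStage m1 NP.≤-refl) ⟩
      det (suc N) (matOf (suc N) Final)
    ≡⟨ sym (detT (suc N) (matOf (suc N) Final)) ⟩
      det (suc N) (transpose (matOf (suc N) Final))
    ≡⟨ lastRow N (transpose (matOf (suc N) Final)) (gHorner n)
         (trans (cong (λ z → Final z z) (FP.toℕ-fromℕ N)) Final-corner)
         (λ j → trans (cong₂ Final (FP.toℕ-inject₁ j) (FP.toℕ-fromℕ N))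
                 (Final-lastCol (toℕ j) (FP.toℕ<n j))) ⟩
      gHorner n * det N (transpose (λ i j → matOf (suc N) Final (inject₁ i) (inject₁ j)))
    ≡⟨ cong (gHorner n *_) (detT N (λ i j → matOf (suc N) Final (inject₁ i) (inject₁ j))) ⟩
      gHorner n * det N (λ i j → matOf (suc N) Final (inject₁ i) (inject₁ j))
    ≡⟨ cong (gHorner n *_) (det-ext N (λ i j → trans (cong₂ Final (FP.toℕ-inject₁ i) (FP.toℕ-inject₁ j))
          (Final-top (toℕ i) (toℕ j) (FP.toℕ<n i)))) ⟩
      gHorner n * det N (matOf N (sylvesterGen m1 n F1 G))
    ∎
    where open ≡-Reasoning


addPoly : Poly → Poly → Poly
addPoly [] q = q
addPoly (a ∷ as) [] = a ∷ as
addPoly (a ∷ as) (b ∷ bs) = (a + b) ∷ addPoly as bs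

scalePoly : ℤ → Poly → Poly
scalePoly c [] = []
scalePoly c (a ∷ as) = (c * a) ∷ scalePoly c as

mulPoly : Poly → Poly → Poly
mulPoly [] q = []
mulPoly (a ∷ as) q = addPoly (scalePoly a q) (0ℤ ∷ mulPoly as q)

linMulAdd : ℤ → ℤ → Poly → Poly
linMulAdd a c [] = c ∷ []
linMulAdd a c (d ∷ ds) = (c - a * d) ∷ linMulAdd a d ds

prodLin : List ℤ → Poly
prodLin [] = 1ℤ ∷ []
prodLin (a ∷ as) = linMulAdd a 0ℤ (prodLin as)

prodEval : Poly → List ℤ → ℤ
prodEval g [] = 1ℤ
prodEval g (a ∷ as) = eval g a * prodEval g as

prodAt : ℤ → List ℤ → ℤ
prodAt y [] = 1ℤ
prodAt y (a ∷ as) = (y - a) * prodAt y as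

eval-add : ∀ f g x → eval (addPoly f g) x ≡ eval f x + eval g x
eval-add [] g x = sym (ℤP.+-identityˡ (eval g x))
eval-add (a ∷ as) [] x = sym (ℤP.+-identityʳ (a + x * eval as x))
eval-add (a ∷ as) (b ∷ bs) x = trans (cong (λ z → a + b + x * z) (eval-add as bs x))
  (distrib a b x (eval as x) (eval bs x))
  where distrib : ∀ a b x u v → a + b + x * (u + v) ≡ a + x * u + (b + x * v)
        distrib = solve-∀

eval-scale : ∀ c f x → eval (scalePoly c f) x ≡ c * eval f x
eval-scale c [] x = sym (ℤP.*-zeroʳ c)
eval-scale c (a ∷ as) x = trans (cong (λ z → c * a + x * z) (eval-scale c as x)) (distrib c a x (eval as x))
  where distrib : ∀ c a x u → c * a + x * (c * u) ≡ c * (a + x * u)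
        distrib = solve-∀

eval-mul : ∀ f g x → eval (mulPoly f g) x ≡ eval f x * eval g x
eval-mul [] g x = refl
eval-mul (a ∷ as) g x = trans (eval-add (scalePoly a g) (0ℤ ∷ mulPoly as g) x)
  (trans (cong₂ (λ u v → u + (0ℤ + x * v)) (eval-scale a g x) (eval-mul as g x)) (distrib a x (eval as x) (eval g x)))
  where distrib : ∀ a x u v → a * v + (0ℤ + x * (u * v)) ≡ (a + x * u) * v
        distrib = solve-∀

eval-linMulAdd : ∀ a c cs x → eval (linMulAdd a c cs) x ≡ c + (x - a) * eval cs x
eval-linMulAdd a c [] x = trans (cong (_+_ c) (ℤP.*-zeroʳ x)) (sym (cong (_+_ c) (ℤP.*-zeroʳ (x - a))))
eval-linMulAdd a c (d ∷ ds) x = trans (cong (λ z → c - a * d + x * z) (eval-linMulAdd a d ds x)) (regroup c a d x (eval ds x))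
  where regroup : ∀ c a d x e → c - a * d + x * (d + (x - a) * e) ≡ c + (x - a) * (d + x * e)
        regroup = solve-∀

eval-prodLin : ∀ as x → eval (prodLin as) x ≡ prodAt x as
eval-prodLin [] x = cong (_+_ 1ℤ) (ℤP.*-zeroʳ x)
eval-prodLin (a ∷ as) x = trans (eval-linMulAdd a 0ℤ (prodLin as) x)
  (trans (ℤP.+-identityˡ ((x - a) * eval (prodLin as) x)) (cong ((x - a) *_) (eval-prodLin as x)))

prodAt-++ : ∀ x as bs → prodAt x (as ++ bs) ≡ prodAt x as * prodAt x bs
prodAt-++ x [] bs = sym (ℤP.*-identityˡ (prodAt x bs))
prodAt-++ x (a ∷ as) bs = trans (cong ((x - a) *_) (prodAt-++ x as bs)) (sym (ℤP.*-assoc (x - a) (prodAt x as) (prodAt x bs)))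

prodEval-++ : ∀ g as bs → prodEval g (as ++ bs) ≡ prodEval g as * prodEval g bs
prodEval-++ g [] bs = sym (ℤP.*-identityˡ (prodEval g bs))
prodEval-++ g (a ∷ as) bs = trans (cong (eval g a *_) (prodEval-++ g as bs)) (sym (ℤP.*-assoc (eval g a) (prodEval g as) (prodEval g bs)))

length-add : ∀ f g → length (addPoly f g) ≡ length f ⊔ length g
length-add [] g = refl
length-add (a ∷ as) [] = refl
length-add (a ∷ as) (b ∷ bs) = cong suc (length-add as bs)

length-scale : ∀ c f → length (scalePoly c f) ≡ length f
length-scale c [] = refl
length-scale c (a ∷ as) = cong suc (length-scale c as)

length-mul : ∀ f g → 1 ≤ length g → suc (length (mulPoly f g)) ≤ length f ℕ.+ length g
length-mul [] g le = le
length-mul (a ∷ as) g le = subst (λ z → suc z ≤ suc (length as ℕ.+ length g)) (sym (length-add (scalePoly a g) (0ℤ ∷ mulPoly as g)))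
  (s≤s (NP.⊔-lub (subst (_≤ length as ℕ.+ length g) (sym (length-scale a g)) (NP.m≤n+m (length g) (length as)))
                 (length-mul as g le)))

length-linMulAdd : ∀ a c cs → length (linMulAdd a c cs) ≡ suc (length cs)
length-linMulAdd a c [] = refl
length-linMulAdd a c (d ∷ ds) = cong suc (length-linMulAdd a d ds)

length-prodLin : ∀ as → length (prodLin as) ≡ suc (length as)
length-prodLin [] = refl
length-prodLin (a ∷ as) = trans (length-linMulAdd a 0ℤ (prodLin as)) (cong suc (length-prodLin as))

last-cons : ∀ (c : ℤ) cs {n} → length cs ≡ suc n → last (c ∷ cs) ≡ last cs
last-cons c (d ∷ ds) _ = refl

last-linMulAdd : ∀ a c cs → last (linMulAdd a c cs) ≡ last (c ∷ cs)
last-linMulAdd a c [] = refl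
last-linMulAdd a c (d ∷ []) = refl
last-linMulAdd a c (d ∷ e ∷ es) = last-linMulAdd a d (e ∷ es)

prodLin-monic : ∀ as → Monic (prodLin as)
prodLin-monic [] = refl
prodLin-monic (a ∷ as) = trans (last-linMulAdd a 0ℤ (prodLin as))
  (trans (last-cons 0ℤ (prodLin as) (length-prodLin as)) (prodLin-monic as))

last-add : ∀ f g → length g < length f → last (addPoly f g) ≡ last f
last-add (a ∷ []) [] _ = refl
last-add (a ∷ b ∷ as) [] _ = refl
last-add (a ∷ []) (c ∷ cs) (s≤s ())
last-add (a ∷ b ∷ as) (c ∷ []) (s≤s lt) = refl
last-add (a ∷ b ∷ as) (c ∷ d ∷ cs) (s≤s lt) =
  trans (last-cons (a + c) (addPoly (b ∷ as) (d ∷ cs)) refl) (last-add (b ∷ as) (d ∷ cs) lt)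

coeff-linMulAdd-suc : ∀ a c cs k → coeff (linMulAdd a c cs) (suc k) ≡ coeff cs k - a * coeff cs (suc k)
coeff-linMulAdd-suc a c [] k = sym (trans (cong (_-_ 0ℤ) (ℤP.*-zeroʳ a)) (ℤP.+-identityʳ 0ℤ))
coeff-linMulAdd-suc a c (d ∷ []) zero = sym (trans (cong (_-_ d) (ℤP.*-zeroʳ a)) (ℤP.+-identityʳ d))
coeff-linMulAdd-suc a c (d ∷ e ∷ es) zero = refl
coeff-linMulAdd-suc a c (d ∷ ds) (suc k) = coeff-linMulAdd-suc a d ds k

coeff-linMulAdd-0 : ∀ a cs → coeff (linMulAdd a 0ℤ cs) 0 ≡ - (a * coeff cs 0)
coeff-linMulAdd-0 a [] = sym (cong -_ (ℤP.*-zeroʳ a))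
coeff-linMulAdd-0 a (c ∷ cs) = ℤP.+-identityˡ (- (a * c))

coeff-beyond : ∀ cs k → length cs ≤ k → coeff cs k ≡ 0ℤ
coeff-beyond [] k _ = refl
coeff-beyond (c ∷ cs) (suc k) (s≤s le) = coeff-beyond cs k le

length-prodLin-deg : ∀ as → length (prodLin as) ≡ suc (deg (prodLin as))
length-prodLin-deg as = trans (length-prodLin as) (cong suc (sym (cong (_∸ 1) (length-prodLin as))))

det-identity : ∀ n (R : ℕ → ℤ) → R 0 ≡ 1ℤ → (∀ e → R (suc e) ≡ 0ℤ) → det n (matOf n (λ i j → shiftRow i R j)) ≡ 1ℤ
det-identity zero R r0 rs = refl
det-identity (suc n) R r0 rs = begin
    sg {suc n} F.zero * (R 0 * det n (Id n))
      + sumFin n (λ j → sg (F.suc j) * (R (suc (toℕ j)) * det n (minor (Id (suc n)) (F.suc j))))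
  ≡⟨ cong₂ _+_ (cong (λ z → 1ℤ * (z * det n (Id n))) r0) (sumFin-0 n offDiagonal) ⟩
    1ℤ * (1ℤ * det n (Id n)) + 0ℤ
  ≡⟨ cong (λ z → 1ℤ * (1ℤ * z) + 0ℤ) (det-identity n R r0 rs) ⟩
    1ℤ
  ∎
  where
  open ≡-Reasoning
  Id : ∀ m → Mat m
  Id m = matOf m (λ i j → shiftRow i R j)
  offDiagonal : ∀ j → sg (F.suc j) * (R (suc (toℕ j)) * det n (minor (Id (suc n)) (F.suc j))) ≡ 0ℤ
  offDiagonal j = trans (cong (λ z → sg (F.suc j) * (z * det n (minor (Id (suc n)) (F.suc j)))) (rs (toℕ j)))
    (trans (cong (sg (F.suc j) *_) (ℤP.*-zeroˡ (det n (minor (Id (suc n)) (F.suc j))))) (ℤP.*-zeroʳ (sg (F.suc j))))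

horner-upto : ∀ a {R R'} t → (∀ e → e ≤ t → R e ≡ R' e) → horner a R t ≡ horner a R' t
horner-upto a zero eq = eq zero z≤n
horner-upto a (suc t) eq =
  cong₂ (λ u v → u + a * v) (eq (suc t) NP.≤-refl) (horner-upto a t (λ e le → eq e (NP.m≤n⇒m≤1+n le)))

horner-eval : ∀ a g → horner a (revCoeff (deg g) (coeff g)) (deg g) ≡ eval g a
horner-eval a [] = refl
horner-eval a (b ∷ []) = sym (trans (cong (_+_ b) (ℤP.*-zeroʳ a)) (ℤP.+-identityʳ b))
horner-eval a (b ∷ c ∷ cs) = begin
    revCoeff (suc L) (coeff (b ∷ c ∷ cs)) (suc L) + a * horner a (revCoeff (suc L) (coeff (b ∷ c ∷ cs))) L
  ≡⟨ cong₂ (λ u v → u + a * v) (revCoeff-≤ (suc L) (coeff (b ∷ c ∷ cs)) (suc L) 0 (NP.+-identityʳ _))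
           (horner-upto a L tailRow) ⟩
    b + a * horner a (revCoeff L (coeff (c ∷ cs))) L
  ≡⟨ cong (λ z → b + a * z) (horner-eval a (c ∷ cs)) ⟩
    b + a * eval (c ∷ cs) a
  ∎
  where
  open ≡-Reasoning
  L : ℕ
  L = length cs
  tailRow : ∀ e → e ≤ L → revCoeff (suc L) (coeff (b ∷ c ∷ cs)) e ≡ revCoeff L (coeff (c ∷ cs)) e
  tailRow e le = trans (revCoeff-≤ (suc L) (coeff (b ∷ c ∷ cs)) e (suc (L ∸ e)) (trans (NP.+-suc e (L ∸ e)) (cong suc (NP.m+[n∸m]≡n le))))
                       (sym (revCoeff-≤ L (coeff (c ∷ cs)) e (L ∸ e) (NP.m+[n∸m]≡n le)))

resultant-at : ∀ f g m → deg f ≡ m → resultant f g ≡ det (m ℕ.+ deg g) (matOf (m ℕ.+ deg g) (sylvesterGen m (deg g) (coeff f) (coeff g)))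
resultant-at f g .(deg f) refl = refl

resultant-prodLin : ∀ rs g → resultant (prodLin rs) g ≡ prodEval g rs
resultant-prodLin [] g =
  trans (det-ext (deg g) (λ i j → sylvester-fRow 0 (deg g) (coeff (1ℤ ∷ [])) (coeff g) (toℕ i) (toℕ j) (FP.toℕ<n i)))
        (det-identity (deg g) (revCoeff 0 (coeff (1ℤ ∷ []))) refl (λ e → refl))
resultant-prodLin (a ∷ as) g = begin
    resultant f g
  ≡⟨ resultant-at f g (suc (deg f₁)) deg-f ⟩
    det (suc (deg f₁) ℕ.+ deg g) (matOf _ (sylvesterGen (suc (deg f₁)) (deg g) (coeff f) (coeff g)))
  ≡⟨ LinearFactor.det-linearFactor (deg f₁) (deg g) (coeff f) (coeff f₁) (coeff g) a
       (coeff-linMulAdd-0 a f₁) (coeff-linMulAdd-suc a 0ℤ f₁)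
       (λ k lt → coeff-beyond f₁ k (subst (_≤ k) (sym (length-prodLin-deg as)) lt)) ⟩
    horner a (revCoeff (deg g) (coeff g)) (deg g) * resultant f₁ g
  ≡⟨ cong₂ _*_ (horner-eval a g) (resultant-prodLin as g) ⟩
    eval g a * prodEval g as
  ∎
  where
  open ≡-Reasoning
  f₁ = prodLin as
  f = linMulAdd a 0ℤ f₁
  deg-f : deg f ≡ suc (deg f₁)
  deg-f = trans (cong (_∸ 1) (length-linMulAdd a 0ℤ f₁)) (length-prodLin-deg as)

blockL : ℤ → ℕ → List ℤ
blockL o zero = []
blockL o (suc k) = (o + + k) ∷ blockL o k

length-blockL : ∀ o k → length (blockL o k) ≡ k
length-blockL o zero = refl
length-blockL o (suc k) = cong suc (length-blockL o k)

prodAt-blockL-split : ∀ y o k → prodAt y (blockL o (suc k)) ≡ prodAt y (blockL (o + 1ℤ) k) * (y - o)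
prodAt-blockL-split y o zero = comm y o
  where comm : ∀ y o → (y - (o + 0ℤ)) * 1ℤ ≡ 1ℤ * (y - o)
        comm = solve-∀
prodAt-blockL-split y o (suc k) = trans (cong ((y - (o + + suc k)) *_) (prodAt-blockL-split y o k))
  (regroup y o (+ k) (prodAt y (blockL (o + 1ℤ) k)))
  where regroup : ∀ y o k r → (y - (o + (1ℤ + k))) * (r * (y - o)) ≡ (y - (o + 1ℤ + k)) * r * (y - o)
        regroup = solve-∀

prodAt-blockL-shift : ∀ y o k → prodAt y (blockL o k) ≡ prodAt (y - o) (blockL 0ℤ k)
prodAt-blockL-shift y o zero = refl
prodAt-blockL-shift y o (suc k) = cong₂ _*_ (shift y o (+ k)) (prodAt-blockL-shift y o k)
  where shift : ∀ y o k → y - (o + k) ≡ y - o - (0ℤ + k)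
        shift = solve-∀

factor∣prodAt-blockL : ∀ y k r → r < k → (y - + r) ∣ prodAt y (blockL 0ℤ k)
factor∣prodAt-blockL y (suc k) r r<k with r NP.≟ k
... | yes refl = ∣m⇒∣m*n (prodAt y (blockL 0ℤ k)) (subst (λ z → (y - + r) ∣ (y - z)) (sym (ℤP.+-identityˡ (+ r))) ∣-refl)
... | no r≢k = ∣n⇒∣m*n (y - (0ℤ + + k)) (factor∣prodAt-blockL y k r (NP.≤∧≢⇒< (NP.≤-pred r<k) r≢k))

prodAt-self : ∀ a xs ys → prodAt a (xs ++ a ∷ ys) ≡ 0ℤ
prodAt-self a [] ys = trans (cong (_* prodAt a ys) (ℤP.+-inverseʳ a)) (ℤP.*-zeroˡ (prodAt a ys))
prodAt-self a (x ∷ xs) ys = trans (cong ((a - x) *_) (prodAt-self a xs ys)) (ℤP.*-zeroʳ (a - x))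

roots-prodAt : ∀ xs ys → All (λ a → prodAt a (xs ++ ys) ≡ 0ℤ) ys
roots-prodAt xs [] = []
roots-prodAt xs (y ∷ ys) = prodAt-self y xs ys
  ∷ subst (λ l → All (λ a → prodAt a l ≡ 0ℤ) ys) (LP.++-assoc xs (y ∷ []) ys) (roots-prodAt (xs ++ y ∷ []) ys)

prodEval-shift : ∀ f h as → All (λ a → eval f a ≡ 0ℤ) as → prodEval (addPoly f h) as ≡ prodEval h as
prodEval-shift f h [] [] = refl
prodEval-shift f h (a ∷ as) (e ∷ es) =
  cong₂ _*_ (trans (eval-add f h a) (trans (cong (_+ eval h a) e) (ℤP.+-identityˡ (eval h a)))) (prodEval-shift f h as es)

sumE : (ℕ → ℕ) → ℕ → ℕ
sumE E zero = 0
sumE E (suc t) = E t ℕ.+ sumE E t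

sumE-const : ∀ c n → sumE (λ _ → c) n ≡ n ℕ.* c
sumE-const c zero = refl
sumE-const c (suc n) = cong (c ℕ.+_) (sumE-const c n)

exponent-identity : ∀ K S X s → K ℕ.+ s ≡ X ℕ.+ S → + K - + S ≡ + X - + s
exponent-identity K S X s eq = begin
    + K - + S
  ≡⟨ addSub (+ K) (+ S) (+ s) ⟩
    (+ K + + s) - + S - + s
  ≡⟨ cong (λ z → z - + S - + s) (trans (sym (ℤP.pos-+ K s)) (trans (cong +_ eq) (ℤP.pos-+ X S))) ⟩
    (+ X + + S) - + S - + s
  ≡⟨ cancel (+ X) (+ S) (+ s) ⟩
    + X - + s
  ∎
  where
  open ≡-Reasoning
  addSub : ∀ k S s → k - S ≡ (k + s) - S - s
  addSub = solve-∀
  cancel : ∀ x S s → (x + S) - S - s ≡ x - s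
  cancel = solve-∀

Realises : ℕ → ℕ → ℕ → Set
Realises p s S = Σ Poly λ f → Σ Poly λ g →
  Monic f × Monic g × resultant f g ≢ 0ℤ
  × MinVal p (gcdAt f g) s
  × MaxVal p (gcdAt f g) S
  × (∃ λ k → IsVal p (resultant f g) k × (+ k - + S ≡ + (p ℕ.* (s ℕ.* s)) - + s))

module Construction (q : ℕ) (isPrime : Prime (suc (suc q))) where

  p : ℕ
  p = suc (suc q)

  P : ℤ
  P = + p

  pw : ℕ → ℤ
  pw k = + (p ℕ.^ k)

  pw-nonZero : ∀ k → ℤ.NonZero (pw k)
  pw-nonZero k = NP.m^n≢0 p k

  pw-suc : ∀ k → pw (suc k) ≡ P * pw k
  pw-suc k = ℤP.pos-* p (p ℕ.^ k)

  pw-+ : ∀ a b → pw (a ℕ.+ b) ≡ pw a * pw b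
  pw-+ a b = trans (cong +_ (NP.^-distribˡ-+-* p a b)) (ℤP.pos-* (p ℕ.^ a) (p ℕ.^ b))

  pw-1 : pw 1 ≡ P
  pw-1 = trans (pw-suc 0) (ℤP.*-identityʳ P)

  pw-mono : ∀ {a b} → a ≤ b → pw a ∣ pw b
  pw-mono {a} {b} a≤b = divides (pw (b ∸ a))
    (trans (cong pw (sym (NP.m+[n∸m]≡n a≤b))) (trans (pw-+ a (b ∸ a)) (ℤP.*-comm (pw a) (pw (b ∸ a)))))

  P∣pw : ∀ k → P ∣ pw (suc k)
  P∣pw k = divides (pw k) (trans (pw-suc k) (ℤP.*-comm P (pw k)))

  Unit : ℤ → Set
  Unit u = ¬ (P ∣ u)

  euclid : ∀ a b → P ∣ a * b → P ∣ a ⊎ P ∣ b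
  euclid a b d with euclidsLemma ℤ.∣ a ∣ ℤ.∣ b ∣ isPrime (subst (p ND.∣_) (ℤP.abs-* a b) (∣⇒∣ᵤ d))
  ... | inj₁ x = inj₁ (∣ᵤ⇒∣ x)
  ... | inj₂ y = inj₂ (∣ᵤ⇒∣ y)

  unit-* : ∀ {a b} → Unit a → Unit b → Unit (a * b)
  unit-* {a} {b} ua ub d = [ ua , ub ]′ (euclid a b d)

  unit-+ : ∀ {a b} → Unit a → P ∣ b → Unit (a + b)
  unit-+ ua db d = ua (∣m+n∣n⇒∣m d db)

  unit-1 : Unit 1ℤ
  unit-1 d with ND.∣⇒≤ (∣⇒∣ᵤ d)
  ... | s≤s ()

  unit-nat : ∀ m → 0 < m → m < p → Unit (+ m)
  unit-nat m 0<m m<p d = NP.<⇒≱ m<p (ND.∣⇒≤ {{ℕ.>-nonZero 0<m}} (∣⇒∣ᵤ d))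

  unit-cancel : ∀ k {u a} → Unit u → pw k ∣ u * a → pw k ∣ a
  unit-cancel zero {u} {a} uu d = divides a (sym (ℤP.*-identityʳ a))
  unit-cancel (suc k) {u} {a} uu d =
    [ (λ pu → ⊥-elim (uu pu)) , cancelStep ]′ (euclid u a (∣-trans (subst (_∣ pw (suc k)) pw-1 (pw-mono {1} {suc k} (s≤s z≤n))) d))
    where
    regroup : ∀ u a p → u * (a * p) ≡ p * (u * a)
    regroup = solve-∀
    cancelStep : P ∣ a → pw (suc k) ∣ a
    cancelStep (divides a' refl) =
      let d' : P * pw k ∣ P * (u * a')
          d' = subst₂ _∣_ (pw-suc k) (regroup u a' P) d
      in subst (_∣ a' * P) (sym (trans (pw-suc k) (ℤP.*-comm P (pw k))))
               (*-monoˡ-∣ P (unit-cancel k {u} {a'} uu (*-cancelˡ-∣ P d')))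

  record Val (a : ℤ) (k : ℕ) : Set where
    constructor val
    field
      unit    : ℤ
      factors : a ≡ pw k * unit
      isUnit  : Unit unit

  Val-cong : ∀ {a b k l} → a ≡ b → k ≡ l → Val a k → Val b l
  Val-cong refl refl v = v

  Val-unit : ∀ {u} → Unit u → Val u 0
  Val-unit {u} uu = val u (sym (ℤP.*-identityˡ u)) uu

  Val-mul : ∀ {a b k l} → Val a k → Val b l → Val (a * b) (k ℕ.+ l)
  Val-mul {a} {b} {k} {l} (val u refl uu) (val v refl uv) =
    val (u * v) (trans (interchange (pw k) u (pw l) v) (cong (_* (u * v)) (sym (pw-+ k l)))) (unit-* uu uv)
    where interchange : ∀ x y z w → x * y * (z * w) ≡ x * z * (y * w)
          interchange = solve-∀

  Val-scale : ∀ {a k} t → Val a k → Val (pw t * a) (t ℕ.+ k)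
  Val-scale {a} {k} t (val u refl uu) = val u (trans (sym (ℤP.*-assoc (pw t) (pw k) u)) (cong (_* u) (sym (pw-+ t k)))) uu

  Val-pw : ∀ k → Val (pw k) k
  Val-pw k = val 1ℤ (sym (ℤP.*-identityʳ (pw k))) unit-1

  Val≢0 : ∀ {a k} → Val a k → a ≢ 0ℤ
  Val≢0 {a} {k} (val u refl uu) eq with ℤP.i*j≡0⇒i≡0∨j≡0 (pw k) eq
  ... | inj₁ e = ℕ.≢-nonZero⁻¹ (p ℕ.^ k) {{NP.m^n≢0 p k}} (ℤP.+-injective e)
  ... | inj₂ refl = uu (divides 0ℤ refl)

  Val⇒IsVal : ∀ {a k} → Val a k → IsVal p a k
  Val⇒IsVal {a} {k} v@(val u refl uu) = Val≢0 v , ∣⇒∣ᵤ (divides u (ℤP.*-comm (pw k) u)) , notHigher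
    where
    notHigher : ¬ (+ (p ℕ.^ suc k) U.∣ pw k * u)
    notHigher d = uu (*-cancelˡ-∣ (pw k) {{pw-nonZero k}}
      (subst (_∣ pw k * u) (trans (pw-suc k) (ℤP.*-comm P (pw k))) (∣ᵤ⇒∣ d)))

  Val-notHigher : ∀ {a k} → Val a k → ¬ (pw (suc k) ∣ a)
  Val-notHigher {a} {k} v d = proj₂ (proj₂ (Val⇒IsVal v)) (∣⇒∣ᵤ d)

  valExists : ∀ a → a ≢ 0ℤ → Σ ℕ (Val a)
  valExists a nz = go (suc ℤ.∣ a ∣) a NP.≤-refl nz
    where
    go : ∀ fuel a → ℤ.∣ a ∣ < fuel → a ≢ 0ℤ → Σ ℕ (Val a)
    go (suc f) a lt nz with P ∣? a
    ... | no nd = 0 , Val-unit nd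
    ... | yes (divides c refl) =
      let cnz : c ≢ 0ℤ
          cnz = λ e → nz (cong (_* P) e)
          instance _ = ℤ.≢-nonZero cnz
          c<a : ℤ.∣ c ∣ < ℤ.∣ c * P ∣
          c<a = subst (ℤ.∣ c ∣ <_) (sym (ℤP.abs-* c P)) (NP.m<m*n ℤ.∣ c ∣ p (s≤s (s≤s z≤n)))
          (k , val u e uu) = go f c (NP.≤-trans c<a (NP.≤-pred lt)) cnz
      in suc k , val u (trans (cong (_* P) e) (trans (ℤP.*-comm (pw k * u) P)
                         (trans (sym (ℤP.*-assoc P (pw k) u)) (cong (_* u) (sym (pw-suc k)))))) uu

  ∣⇒∣gcd : ∀ {d a b} → d ∣ a → d ∣ b → d ∣ gcd a b
  ∣⇒∣gcd {d} {a} {b} da db = ∣ᵤ⇒∣ (gcd-greatest {a} {b} {d} (∣⇒∣ᵤ da) (∣⇒∣ᵤ db))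

  ∣gcd⇒∣ˡ : ∀ {d} a b → d ∣ gcd a b → d ∣ a
  ∣gcd⇒∣ˡ a b dg = ∣ᵤ⇒∣ (ND.∣-trans (∣⇒∣ᵤ dg) (gcd[i,j]∣i a b))

  ∣gcd⇒∣ʳ : ∀ {d} a b → d ∣ gcd a b → d ∣ b
  ∣gcd⇒∣ʳ a b dg = ∣ᵤ⇒∣ (ND.∣-trans (∣⇒∣ᵤ dg) (gcd[i,j]∣j a b))

  -- at a root n of f:  gcd(f n, f n + h n) = gcd(0, h n) = |h n|
  gcdAtRoot : ∀ a b k → a ≡ 0ℤ → Val b k → IsVal p (gcd a (a + b)) k
  gcdAtRoot .0ℤ b k refl v with Val⇒IsVal v
  ... | nz , d , nd = subst (λ z → IsVal p z k) (sym (trans (cong (gcd 0ℤ) (ℤP.+-identityˡ b)) gcd0))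
                            ((λ e → nz (ℤP.∣i∣≡0⇒i≡0 (ℤP.+-injective e))) , d , nd)
    where
    gcd0 : gcd 0ℤ b ≡ + ℤ.∣ b ∣
    gcd0 = cong +_ (ND.∣-antisym (NG.gcd[m,n]∣n 0 ℤ.∣ b ∣) (NG.gcd-greatest (ℤ.∣ b ∣ ND.∣0) ND.∣-refl))

  minMax : ∀ (h : ℤ → ℤ) s S → (∀ n → pw s ∣ h n) → (∀ n → ¬ (pw (suc S) ∣ h n)) →
    (∃ λ n → IsVal p (h n) s) → (∃ λ n → IsVal p (h n) S) → MinVal p h s × MaxVal p h S
  minMax h s S lo hi w₁ w₂ = (defined , atLeast , w₁) , (defined , atMost , w₂)
    where
    defined : ∀ n → ∃ λ k → IsVal p (h n) k
    defined n =
      let (k , v) = valExists (h n) (λ e → hi n (subst (pw (suc S) ∣_) (sym e) (divides 0ℤ refl)))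
      in k , Val⇒IsVal v
    atLeast : ∀ n k → IsVal p (h n) k → s ≤ k
    atLeast n k (_ , _ , nd) with s NP.≤? k
    ... | yes le = le
    ... | no nle = ⊥-elim (nd (∣⇒∣ᵤ (∣-trans (pw-mono (NP.≰⇒> nle)) (lo n))))
    atMost : ∀ n k → IsVal p (h n) k → k ≤ S
    atMost n k (_ , d , _) with k NP.≤? S
    ... | yes le = le
    ... | no nle = ⊥-elim (hi n (∣-trans (pw-mono (NP.≰⇒> nle)) (∣ᵤ⇒∣ d)))

  offset : ℕ → ℤ
  offset zero = 0ℤ
  offset (suc t) = P * (1ℤ + P * + t)

  P∣offset : ∀ t → P ∣ offset t
  P∣offset zero = divides 0ℤ refl
  P∣offset (suc t) = ∣m⇒∣m*n (1ℤ + P * + t) ∣-refl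

  roots : ℕ → List ℤ
  roots zero = []
  roots (suc t) = blockL (offset t) p ++ roots t

  length-roots : ∀ t → length (roots t) ≡ t ℕ.* p
  length-roots zero = refl
  length-roots (suc t) =
    trans (LP.length-++ (blockL (offset t) p)) (cong₂ ℕ._+_ (length-blockL (offset t) p) (length-roots t))

  prodAt-roots-suc : ∀ y t → prodAt y (roots (suc t)) ≡ prodAt y (blockL (offset t) p) * prodAt y (roots t)
  prodAt-roots-suc y t = prodAt-++ y (blockL (offset t) p) (roots t)

  cofactor : ℤ → ℤ
  cofactor y = prodAt y (blockL 1ℤ (suc q))

  prodAt-block0 : ∀ y → prodAt y (blockL 0ℤ p) ≡ cofactor y * y
  prodAt-block0 y = trans (prodAt-blockL-split y 0ℤ (suc q)) (cong (cofactor y *_) (ℤP.+-identityʳ y))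

  prodAt-block : ∀ y o → prodAt y (blockL o p) ≡ cofactor (y - o) * (y - o)
  prodAt-block y o = trans (prodAt-blockL-shift y o p) (prodAt-block0 (y - o))

  -- p divides a product of p consecutive integers (one factor is y - (y mod p))
  P∣block0 : ∀ y → P ∣ prodAt y (blockL 0ℤ p)
  P∣block0 y = ∣-trans (divides (y DM./ℕ p) eq) (factor∣prodAt-blockL y p (y DM.%ℕ p) (DM.n%ℕd<d y p))
    where
    cancel : ∀ a b → a + b - a ≡ b
    cancel = solve-∀
    eq : y - + (y DM.%ℕ p) ≡ (y DM./ℕ p) * P
    eq = trans (cong (_- + (y DM.%ℕ p)) (DM.a≡a%ℕn+[a/ℕn]*n y p)) (cancel (+ (y DM.%ℕ p)) ((y DM./ℕ p) * P))

  P∣block : ∀ y o → P ∣ prodAt y (blockL o p)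
  P∣block y o = subst (P ∣_) (sym (prodAt-blockL-shift y o p)) (P∣block0 (y - o))

  cofactor-unit : ∀ y → P ∣ y → Unit (cofactor y)
  cofactor-unit y d = go (suc q) NP.≤-refl
    where
    go : ∀ k → k ≤ suc q → Unit (prodAt y (blockL 1ℤ k))
    go zero _ = unit-1
    go (suc k) le = unit-* factor (go k (NP.≤-trans (NP.n≤1+n k) le))
      where
      cancel : ∀ y a → y - (y - a) ≡ a
      cancel = solve-∀
      factor : Unit (y - (1ℤ + + k))
      factor dd = unit-nat (suc k) (s≤s z≤n) (s≤s le) (subst (P ∣_) (cancel y (+ suc k)) (∣m∣n⇒∣m-n d dd))

  P∣cofactor : ∀ y → Unit y → P ∣ cofactor y
  P∣cofactor y uy = [ (λ d → d) , (λ d → ⊥-elim (uy d)) ]′ (euclid (cofactor y) y (subst (P ∣_) (prodAt-block0 y) (P∣block0 y)))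

  *-pres-∣ : ∀ {a b c d} → a ∣ b → c ∣ d → a * c ∣ b * d
  *-pres-∣ {a} {b} {c} {d} (divides x refl) (divides y refl) = divides (x * y) (interchange x a y c)
    where interchange : ∀ x a y c → x * a * (y * c) ≡ x * y * (a * c)
          interchange = solve-∀

  -- p^t divides f(y) for every y: each of the t blocks contributes a factor p
  pw∣prodAt-roots : ∀ y t → pw t ∣ prodAt y (roots t)
  pw∣prodAt-roots y zero = divides 1ℤ (sym (ℤP.*-identityʳ 1ℤ))
  pw∣prodAt-roots y (suc t) =
    subst₂ _∣_ (sym (pw-suc t)) (sym (prodAt-roots-suc y t)) (*-pres-∣ (P∣block y (offset t)) (pw∣prodAt-roots y t))

  prodAt-roots-zero : ∀ y t → prodAt y (blockL 0ℤ p) ≡ 0ℤ → prodAt y (roots (suc t)) ≡ 0ℤ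
  prodAt-roots-zero y zero e = trans (prodAt-roots-suc y 0) (cong (_* 1ℤ) e)
  prodAt-roots-zero y (suc t) e =
    trans (prodAt-roots-suc y (suc t))
          (trans (cong (prodAt y (blockL (offset (suc t)) p) *_) (prodAt-roots-zero y t e)) (ℤP.*-zeroʳ (prodAt y (blockL (offset (suc t)) p))))

  block0-root-0 : prodAt 0ℤ (blockL 0ℤ p) ≡ 0ℤ
  block0-root-0 = trans (prodAt-block0 0ℤ) (ℤP.*-zeroʳ (cofactor 0ℤ))

  block0-root-1 : prodAt 1ℤ (blockL 0ℤ p) ≡ 0ℤ
  block0-root-1 = trans (prodAt-block0 1ℤ)
    (cong (_* 1ℤ) (trans (prodAt-blockL-split 1ℤ 1ℤ q) (ℤP.*-zeroʳ (prodAt 1ℤ (blockL (1ℤ + 1ℤ) q)))))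

  Val-prodEval-block : ∀ (h : Poly) o k e₀ e → Val (eval h (o + + 0)) e₀ → (∀ i → i < k → Val (eval h (o + + suc i)) e) →
    Val (prodEval h (blockL o (suc k))) (e₀ ℕ.+ k ℕ.* e)
  Val-prodEval-block h o zero e₀ e v₀ vs = Val-mul v₀ (Val-unit unit-1)
  Val-prodEval-block h o (suc k) e₀ e v₀ vs =
    Val-cong refl (exchange e e₀ (k ℕ.* e))
      (Val-mul
        (vs k NP.≤-refl) (Val-prodEval-block h o k e₀ e v₀ (λ i lt → vs i (NP.m<n⇒m<1+n lt))))
    where exchange : ∀ a b c → a ℕ.+ (b ℕ.+ c) ≡ b ℕ.+ (a ℕ.+ c)
          exchange = NRS.solve-∀

  Val-prodEval-roots : ∀ (h : Poly) (E : ℕ → ℕ) t → (∀ t' → t' < t → Val (prodEval h (blockL (offset t') p)) (E t')) →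
    Val (prodEval h (roots t)) (sumE E t)
  Val-prodEval-roots h E zero vb = Val-unit unit-1
  Val-prodEval-roots h E (suc t) vb = Val-cong {k = E t ℕ.+ sumE E t} (sym (prodEval-++ h (blockL (offset t) p) (roots t))) refl
    (Val-mul
      (vb t NP.≤-refl) (Val-prodEval-roots h E t (λ t' lt → vb t' (NP.m<n⇒m<1+n lt))))

  -- What has to be checked about a root list rs and a perturbation h so that
  -- f = ∏_{r ∈ rs} (x - r) and g = f + h realise (s, S) with v(Res f g) = K.
  record Certificate (rs : List ℤ) (h : Poly) (s S K : ℕ) : Set where
    field
      deg-h<deg-f   : length h < suc (length rs)
      val-resultant : Val (prodEval h rs) K
      exponent      : + K - + S ≡ + (p ℕ.* (s ℕ.* s)) - + s
      lower         : ∀ n → pw s ∣ prodAt n rs × pw s ∣ eval h n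
      upper         : ∀ n → pw (suc S) ∣ prodAt n rs → pw (suc S) ∣ eval h n → ⊥
      attains-min   : ∃ λ n → IsVal p (gcd (prodAt n rs) (prodAt n rs + eval h n)) s
      attains-max   : ∃ λ n → IsVal p (gcd (prodAt n rs) (prodAt n rs + eval h n)) S

  -- A certificate yields the theorem: g is monic because deg h < deg f, Res(f, g) = ∏ g(r) = ∏ h(r)
  -- since f vanishes on rs, and gcd(f n, g n) = gcd(f n, f n + h n) is controlled by lower/upper.
  certificate⇒realises : ∀ rs h s S K → Certificate rs h s S K → Realises p s S
  certificate⇒realises rs h s S K c =
    f , g , prodLin-monic rs , monic-g , proj₁ isVal , proj₁ minmax , proj₂ minmax , K , isVal , exponent
    where
    open Certificate c
    f = prodLin rs
    g = addPoly f h
    monic-g : Monic g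
    monic-g = trans (last-add f h (subst (length h <_) (sym (length-prodLin rs)) deg-h<deg-f)) (prodLin-monic rs)
    res : resultant f g ≡ prodEval h rs
    res = trans (resultant-prodLin rs g)
                (prodEval-shift f h rs (All.map (λ {a} e → trans (eval-prodLin rs a) e) (roots-prodAt [] rs)))
    isVal : IsVal p (resultant f g) K
    isVal = subst (λ z → IsVal p z K) (sym res) (Val⇒IsVal val-resultant)
    gcd-eq : ∀ n → gcdAt f g n ≡ gcd (prodAt n rs) (prodAt n rs + eval h n)
    gcd-eq n = cong₂ gcd (eval-prodLin rs n) (trans (eval-add f h n) (cong (_+ eval h n) (eval-prodLin rs n)))
    transport : ∀ {k} → (∃ λ n → IsVal p (gcd (prodAt n rs) (prodAt n rs + eval h n)) k) → ∃ λ n → IsVal p (gcdAt f g n) k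
    transport {k} (n , v) = n , subst (λ z → IsVal p z k) (sym (gcd-eq n)) v
    lower-gcd : ∀ n → pw s ∣ gcdAt f g n
    lower-gcd n = subst (pw s ∣_) (sym (gcd-eq n)) (∣⇒∣gcd df (∣m∣n⇒∣m+n df (proj₂ (lower n))))
      where df = proj₁ (lower n)
    upper-gcd : ∀ n → ¬ (pw (suc S) ∣ gcdAt f g n)
    upper-gcd n d = upper n df (∣m+n∣m⇒∣n dg df)
      where
      fn = prodAt n rs
      gn = fn + eval h n
      d' : pw (suc S) ∣ gcd fn gn
      d' = subst (pw (suc S) ∣_) (gcd-eq n) d
      df = ∣gcd⇒∣ˡ fn gn d'
      dg = ∣gcd⇒∣ʳ fn gn d'
    minmax = minMax (gcdAt f g) s S lower-gcd upper-gcd (transport {s} attains-min) (transport {S} attains-max)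

  eval-const : ∀ c x → eval (c ∷ []) x ≡ c
  eval-const c x = trans (cong (_+_ c) (ℤP.*-zeroʳ x)) (ℤP.+-identityʳ c)

  -- Case s = 0:  f = x,  g = x + p^S.  Res = p^S; gcd(n, n + p^S) = gcd(n, p^S).
  certificate-s=0 : ∀ S → Certificate (0ℤ ∷ []) (pw S ∷ []) 0 S S
  certificate-s=0 S = record
    { deg-h<deg-f   = s≤s (s≤s z≤n)
    ; val-resultant = Val-cong (sym (trans (ℤP.*-identityʳ _) (eval-const (pw S) 0ℤ))) refl (Val-pw S)
    ; exponent      = exponent-identity S S (p ℕ.* 0) 0 (trans (NP.+-identityʳ S) (cong (ℕ._+ S) (sym (NP.*-zeroʳ p))))
    ; lower         = λ n → divides (prodAt n (0ℤ ∷ [])) (sym (ℤP.*-identityʳ _)) , divides (eval (pw S ∷ []) n) (sym (ℤP.*-identityʳ _))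
    ; upper         = λ n _ d → Val-notHigher (Val-pw S) (subst (pw (suc S) ∣_) (eval-const (pw S) n) d)
    ; attains-min   = 1ℤ , subst (λ z → IsVal p z 0) (sym (gcd-zeroˡ (1ℤ + eval (pw S ∷ []) 1ℤ))) (Val⇒IsVal (Val-unit unit-1))
    ; attains-max   = 0ℤ , gcdAtRoot (prodAt 0ℤ (0ℤ ∷ [])) (eval (pw S ∷ []) 0ℤ) S (ℤP.*-zeroˡ 1ℤ) (Val-cong (sym (eval-const (pw S) 0ℤ)) refl (Val-pw S))
    }

  -- Case s = S ≥ 1:  f = ∏_{r ∈ roots s} (x - r),  h = p^s.  Every gcd is exactly p^s (p^s ∣ f n),
  -- and Res = (p^s)^(p s).
  certificate-s=S : ∀ s₁ → let s = suc s₁ in Certificate (roots s) (pw s ∷ []) s s (sumE (λ _ → s ℕ.+ suc q ℕ.* s) s)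
  certificate-s=S s₁ = record
    { deg-h<deg-f   = s≤s (subst (1 ≤_) (sym (length-roots s)) (s≤s z≤n))
    ; val-resultant = Val-prodEval-roots h E s (λ t _ →
                        Val-prodEval-block h (offset t) (suc q) s s (val-h (offset t + + 0)) (λ i _ → val-h (offset t + + suc i)))
    ; exponent      = exponent-identity (sumE E s) s (p ℕ.* (s ℕ.* s)) s
                        (cong (ℕ._+ s) (trans (sumE-const (s ℕ.+ suc q ℕ.* s) s) (total s₁ q)))
    ; lower         = λ n → pw∣prodAt-roots n s , divides 1ℤ (trans (eval-const (pw s) n) (sym (ℤP.*-identityˡ (pw s))))
    ; upper         = λ n _ d → Val-notHigher (Val-pw s) (subst (pw (suc s) ∣_) (eval-const (pw s) n) d)
    ; attains-min   = 0ℤ , gcdAtRoot (prodAt 0ℤ (roots s)) (eval h 0ℤ) s (prodAt-roots-zero 0ℤ s₁ block0-root-0) (val-h 0ℤ)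
    ; attains-max   = 0ℤ , gcdAtRoot (prodAt 0ℤ (roots s)) (eval h 0ℤ) s (prodAt-roots-zero 0ℤ s₁ block0-root-0) (val-h 0ℤ)
    }
    where
    s = suc s₁
    h = pw s ∷ []
    E : ℕ → ℕ
    E _ = s ℕ.+ suc q ℕ.* s
    val-h : ∀ x → Val (eval h x) s
    val-h x = Val-cong (sym (eval-const (pw s) x)) refl (Val-pw s)
    total : ∀ s₁ q → suc s₁ ℕ.* (suc s₁ ℕ.+ suc q ℕ.* suc s₁) ≡ suc (suc q) ℕ.* (suc s₁ ℕ.* suc s₁)
    total = NRS.solve-∀

  -- Case s = 1 < S:  f = ∏_{r = 0}^{p-1} (x - r),  h = p (x + p^(S-1)).
  -- v(h n) = 1 for p ∤ n and h 0 = p^S; if p^(S+1) divided both f n and h n then p ∣ n,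
  -- so p^(S+1) ∣ n (the cofactor is a unit) and p^S ∣ p^(S-1), absurd.
  -- Res = p^S · p^(p-1).
  module CaseOne (d : ℕ) where

    S : ℕ
    S = suc (suc d)

    h : Poly
    h = pw S ∷ P ∷ []

    eval-h : ∀ x → eval h x ≡ P * (x + pw (suc d))
    eval-h x = trans (cong (λ z → z + x * (P + x * 0ℤ)) (pw-suc (suc d))) (factor P (pw (suc d)) x)
      where factor : ∀ P w x → P * w + x * (P + x * 0ℤ) ≡ P * (x + w)
            factor = solve-∀

    val-h-unit : ∀ x → Unit x → Val (eval h x) 1
    val-h-unit x ux = Val-cong (trans (cong (_* (x + pw (suc d))) pw-1) (sym (eval-h x))) refl
      (Val-scale 1 (Val-unit (unit-+ ux (P∣pw d))))

    val-h-0 : Val (eval h 0ℤ) S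
    val-h-0 = Val-cong (trans (trans (pw-suc (suc d)) (cong (P *_) (sym (ℤP.+-identityˡ (pw (suc d)))))) (sym (eval-h 0ℤ))) refl (Val-pw S)

    E : ℕ → ℕ
    E _ = S ℕ.+ suc q ℕ.* 1

    val-block : ∀ t → t < 1 → Val (prodEval h (blockL (offset t) p)) (E t)
    val-block zero _ = Val-prodEval-block h 0ℤ (suc q) S 1 val-h-0
      (λ i lt → val-h-unit (0ℤ + + suc i) (subst Unit (sym (ℤP.+-identityˡ (+ suc i))) (unit-nat (suc i) (s≤s z≤n) (s≤s lt))))
    val-block (suc t) (s≤s ())

    upper : ∀ n → pw (suc S) ∣ prodAt n (roots 1) → pw (suc S) ∣ eval h n → ⊥
    upper n df dh = Val-notHigher (Val-pw (suc d)) (subst (pw S ∣_) (cancel n (pw (suc d))) (∣m∣n⇒∣m-n pwS∣n+w pwS∣n))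
      where
      cancel : ∀ n w → n + w - n ≡ w
      cancel = solve-∀
      pwS∣n+w : pw S ∣ n + pw (suc d)
      pwS∣n+w = *-cancelˡ-∣ P (subst₂ _∣_ (pw-suc S) (eval-h n) dh)
      P∣n : P ∣ n
      P∣n = ∣m+n∣n⇒∣m (∣-trans (P∣pw (suc d)) pwS∣n+w) (P∣pw d)
      f-n : prodAt n (roots 1) ≡ cofactor n * n
      f-n = trans (prodAt-roots-suc n 0) (trans (ℤP.*-identityʳ (prodAt n (blockL 0ℤ p))) (prodAt-block0 n))
      pwS∣n : pw S ∣ n
      pwS∣n = ∣-trans (pw-mono (NP.n≤1+n S)) (unit-cancel (suc S) (cofactor-unit n P∣n) (subst (pw (suc S) ∣_) f-n df))

    certificate : Certificate (roots 1) h 1 S (sumE E 1)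
    certificate = record
      { deg-h<deg-f   = s≤s (s≤s (s≤s z≤n))
      ; val-resultant = Val-prodEval-roots h E 1 val-block
      ; exponent      = exponent-identity (sumE E 1) S (p ℕ.* (1 ℕ.* 1)) 1 (total S q)
      ; lower         = λ n → pw∣prodAt-roots n 1 , subst (_∣ eval h n) (sym pw-1) (divides (n + pw (suc d)) (trans (eval-h n) (ℤP.*-comm P (n + pw (suc d)))))
      ; upper         = upper
      ; attains-min   = 1ℤ , gcdAtRoot (prodAt 1ℤ (roots 1)) (eval h 1ℤ) 1 (prodAt-roots-zero 1ℤ 0 block0-root-1) (val-h-unit 1ℤ unit-1)
      ; attains-max   = 0ℤ , gcdAtRoot (prodAt 0ℤ (roots 1)) (eval h 0ℤ) S (prodAt-roots-zero 0ℤ 0 block0-root-0) val-h-0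
      }
      where
      total : ∀ S q → S ℕ.+ suc q ℕ.* 1 ℕ.+ 0 ℕ.+ 1 ≡ suc (suc q) ℕ.* (1 ℕ.* 1) ℕ.+ S
      total = NRS.solve-∀

  -- Case 2 ≤ s < S  (s = s₂ + 2, S = s + d₁, d₁ = d + 1):
  --   f = ∏_{r ∈ roots s} (x - r),   h = p^s (x + p^d₁) + p^(s-1) x Q(x)²,   Q = cofactor,
  -- so h x = p^(s-1) · core x with core x = p (x + p^d₁) + x Q(x)².
  --  • v(core x) = 1 when p ∤ x (then p ∣ Q x) and when x = m p with p ∤ m (then Q x is a unit);
  --    so v(h x) = s at all roots except 0, where h 0 = p^S.
  --  • Upper bound: p^(S+1) ∣ h x forces x = m p and p^(d₁+1) ∣ m W + p^d₁ with W = p + Q² a unit,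
  --    hence v(m) = d₁; but then v(f x) = (d₁ + 1) + (s - 1) = S.
  --  • Res: block 0 contributes S + (p-1) s, each of the other s - 1 blocks contributes p s.
  -- Here deg h = 2p - 1 < p s = deg f needs s ≥ 2.
  module CaseMany (s₂ d : ℕ) where

    s₁ s d₁ S : ℕ
    s₁ = suc s₂
    s = suc s₁
    d₁ = suc d
    S = s ℕ.+ d₁

    cofactorPoly : Poly
    cofactorPoly = prodLin (blockL 1ℤ (suc q))

    h : Poly
    h = addPoly (scalePoly (pw s) (pw d₁ ∷ 1ℤ ∷ [])) (scalePoly (pw s₁) (0ℤ ∷ mulPoly cofactorPoly cofactorPoly))

    core : ℤ → ℤ
    core x = P * (x + pw d₁) + x * (cofactor x * cofactor x)

    eval-h : ∀ x → eval h x ≡ pw s₁ * core x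
    eval-h x = begin
        eval h x
      ≡⟨ eval-add (scalePoly (pw s) lin) (scalePoly (pw s₁) (0ℤ ∷ mulPoly cofactorPoly cofactorPoly)) x ⟩
        eval (scalePoly (pw s) lin) x + eval (scalePoly (pw s₁) (0ℤ ∷ mulPoly cofactorPoly cofactorPoly)) x
      ≡⟨ cong₂ _+_ (eval-scale (pw s) lin x) (eval-scale (pw s₁) (0ℤ ∷ mulPoly cofactorPoly cofactorPoly) x) ⟩
        pw s * (pw d₁ + x * (1ℤ + x * 0ℤ)) + pw s₁ * (0ℤ + x * eval (mulPoly cofactorPoly cofactorPoly) x)
      ≡⟨ cong₂ (λ u v → u * (pw d₁ + x * (1ℤ + x * 0ℤ)) + pw s₁ * (0ℤ + x * v)) (pw-suc s₁)
           (trans (eval-mul cofactorPoly cofactorPoly x) (cong₂ _*_ (eval-prodLin (blockL 1ℤ (suc q)) x) (eval-prodLin (blockL 1ℤ (suc q)) x))) ⟩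
        P * pw s₁ * (pw d₁ + x * (1ℤ + x * 0ℤ)) + pw s₁ * (0ℤ + x * (cofactor x * cofactor x))
      ≡⟨ factor P (pw s₁) (pw d₁) x (cofactor x) ⟩
        pw s₁ * core x
      ∎
      where
      open ≡-Reasoning
      lin : Poly
      lin = pw d₁ ∷ 1ℤ ∷ []
      factor : ∀ P w d x Q → P * w * (d + x * (1ℤ + x * 0ℤ)) + w * (0ℤ + x * (Q * Q)) ≡ w * (P * (x + d) + x * (Q * Q))
      factor = solve-∀

    val-h-from-core : ∀ x → Val (core x) 1 → Val (eval h x) s
    val-h-from-core x v = Val-cong (sym (eval-h x)) (NP.+-comm s₁ 1) (Val-scale s₁ v)

    -- p ∤ x:  core x = p (x + p^d₁ + p x c²)  where Q x = c p
    val-h-unit : ∀ x → Unit x → Val (eval h x) s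
    val-h-unit x ux = val-h-from-core x (val-core (P∣cofactor x ux))
      where
      regroup : ∀ P x w c → P * (x + (w + P * (x * (c * c)))) ≡ P * (x + w) + x * (c * P * (c * P))
      regroup = solve-∀
      val-core : P ∣ cofactor x → Val (core x) 1
      val-core (divides c e) =
        Val-cong (trans (cong (_* (x + (pw d₁ + P * (x * (c * c))))) pw-1)
                        (trans (regroup P x (pw d₁) c) (cong (λ z → P * (x + pw d₁) + x * (z * z)) (sym e))))
                 refl
                 (Val-scale 1 (Val-unit (unit-+ ux (∣m∣n⇒∣m+n (P∣pw d) (∣m⇒∣m*n (x * (c * c)) ∣-refl)))))

    -- x = m p with p ∤ m:  core x = p (m Q² + m p + p^d₁)
    val-h-pUnit : ∀ m → Unit m → Val (eval h (m * P)) s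
    val-h-pUnit m um = val-h-from-core (m * P)
      (Val-cong (trans (cong (_* (m * (Q * Q) + (m * P + pw d₁))) pw-1) (regroup P m (pw d₁) Q)) refl
        (Val-scale 1 (Val-unit (unit-+ (unit-* um (unit-* uQ uQ)) (∣m∣n⇒∣m+n (∣n⇒∣m*n m ∣-refl) (P∣pw d))))))
      where
      Q = cofactor (m * P)
      uQ : Unit Q
      uQ = cofactor-unit (m * P) (∣n⇒∣m*n m ∣-refl)
      regroup : ∀ P m w Q → P * (m * (Q * Q) + (m * P + w)) ≡ P * (m * P + w) + m * P * (Q * Q)
      regroup = solve-∀

    val-h-0 : Val (eval h 0ℤ) S
    val-h-0 = Val-cong (trans pwS (sym (eval-h 0ℤ))) refl (Val-pw S)
      where
      regroup : ∀ P w d Q → P * w * d ≡ w * (P * (0ℤ + d) + 0ℤ * (Q * Q))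
      regroup = solve-∀
      pwS : pw S ≡ pw s₁ * core 0ℤ
      pwS = trans (pw-+ s d₁) (trans (cong (_* pw d₁) (pw-suc s₁)) (regroup P (pw s₁) (pw d₁) (cofactor 0ℤ)))

    offset+i-unit : ∀ t i → i < suc q → Unit (offset t + + suc i)
    offset+i-unit t i lt dd =
      unit-nat (suc i) (s≤s z≤n) (s≤s lt) (subst (P ∣_) (cancel (offset t) (+ suc i)) (∣m∣n⇒∣m-n dd (P∣offset t)))
      where cancel : ∀ o a → o + a - o ≡ a
            cancel = solve-∀

    E : ℕ → ℕ
    E zero = S ℕ.+ suc q ℕ.* s
    E (suc t) = s ℕ.+ suc q ℕ.* s

-- in block t ≥ 1 the first point is p(1 + p t), a unit times p
    val-block : ∀ t → t < s → Val (prodEval h (blockL (offset t) p)) (E t)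
    val-block zero _ = Val-prodEval-block h 0ℤ (suc q) S s val-h-0 (λ i lt → val-h-unit (0ℤ + + suc i) (offset+i-unit 0 i lt))
    val-block (suc t) _ = Val-prodEval-block h (offset (suc t)) (suc q) s s
      (Val-cong (cong (eval h) (regroup P (+ t))) refl (val-h-pUnit (1ℤ + P * + t) (unit-+ unit-1 (∣m⇒∣m*n (+ t) ∣-refl))))
      (λ i lt → val-h-unit (offset (suc t) + + suc i) (offset+i-unit (suc t) i lt))
      where regroup : ∀ P t → (1ℤ + P * t) * P ≡ P * (1ℤ + P * t) + 0ℤ
            regroup = solve-∀

    sumE-E : ∀ t → sumE E (suc t) ≡ (S ℕ.+ suc q ℕ.* s) ℕ.+ t ℕ.* (s ℕ.+ suc q ℕ.* s)
    sumE-E zero = refl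
    sumE-E (suc t) = trans (cong ((s ℕ.+ suc q ℕ.* s) ℕ.+_) (sumE-E t))
      (exchange (s ℕ.+ suc q ℕ.* s) (S ℕ.+ suc q ℕ.* s) (t ℕ.* (s ℕ.+ suc q ℕ.* s)))
      where exchange : ∀ a b c → a ℕ.+ (b ℕ.+ c) ≡ b ℕ.+ (a ℕ.+ c)
            exchange = NRS.solve-∀

    -- p^s ∣ h n:  p ∣ p (n + p^d₁) and p ∣ n Q(n)² = Q(n)·(Q(n) n) ⊇ p ∣ f over the first block
    lower-h : ∀ n → pw s ∣ eval h n
    lower-h n = subst₂ _∣_ (sym (trans (pw-suc s₁) (ℤP.*-comm P (pw s₁)))) (sym (eval-h n))
      (*-pres-∣ (∣-refl {pw s₁})
        (∣m∣n⇒∣m+n (∣m⇒∣m*n (n + pw d₁) ∣-refl)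
          (subst (P ∣_) (regroup (cofactor n) n) (∣m⇒∣m*n (cofactor n) (subst (P ∣_) (prodAt-block0 n) (P∣block0 n))))))
      where regroup : ∀ Q n → Q * n * Q ≡ n * (Q * Q)
            regroup = solve-∀

    length-h : length h < suc (length (roots s))
    length-h = s≤s (NP.≤-trans length-h≤2p (subst (p ℕ.+ p ≤_) (sym (length-roots s)) (NP.+-monoʳ-≤ p (NP.m≤m+n p (s₂ ℕ.* p)))))
      where
      length-cofactor : length cofactorPoly ≡ p
      length-cofactor = trans (length-prodLin (blockL 1ℤ (suc q))) (cong suc (length-blockL 1ℤ (suc q)))
      length-square : suc (length (mulPoly cofactorPoly cofactorPoly)) ≤ p ℕ.+ p
      length-square = subst₂ (λ a b → suc (length (mulPoly cofactorPoly cofactorPoly)) ≤ a ℕ.+ b) length-cofactor length-cofactor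
        (length-mul cofactorPoly cofactorPoly (subst (1 ≤_) (sym length-cofactor) (s≤s z≤n)))
      length-h≤2p : length h ≤ p ℕ.+ p
      length-h≤2p = subst (_≤ p ℕ.+ p)
        (sym (trans (length-add (scalePoly (pw s) (pw d₁ ∷ 1ℤ ∷ [])) (scalePoly (pw s₁) (0ℤ ∷ mulPoly cofactorPoly cofactorPoly)))
               (cong₂ _⊔_ (length-scale (pw s) (pw d₁ ∷ 1ℤ ∷ [])) (length-scale (pw s₁) (0ℤ ∷ mulPoly cofactorPoly cofactorPoly)))))
        (NP.⊔-lub (s≤s (s≤s z≤n)) length-square)

    module AtMultiple (m : ℤ) where

      x : ℤ
      x = m * P

      Q : ℤ
      Q = cofactor x

      unit-Q : Unit Q
      unit-Q = cofactor-unit x (∣n⇒∣m*n m ∣-refl)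

      W : ℤ
      W = P + Q * Q

      unit-W : Unit W
      unit-W = subst Unit (ℤP.+-comm (Q * Q) P) (unit-+ (unit-* unit-Q unit-Q) (∣-refl {P}))

      B : ℤ
      B = m * W + pw d₁

      eval-h-x : eval h x ≡ pw s * B
      eval-h-x = trans (eval-h x) (trans (regroup P (pw s₁) m (pw d₁) Q) (cong (_* B) (sym (pw-suc s₁))))
        where regroup : ∀ P w m d Q → w * (P * (m * P + d) + m * P * (Q * Q)) ≡ P * w * (m * (P + Q * Q) + d)
              regroup = solve-∀

      pw∣B : pw (suc S) ∣ eval h x → pw (suc d₁) ∣ B
      pw∣B dh = *-cancelˡ-∣ (pw s) {{pw-nonZero s}} (subst₂ _∣_ (trans (cong pw (sym (NP.+-suc s d₁))) (pw-+ s (suc d₁))) eval-h-x dh)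

      -- if v(m) = d₁ then v(f x) = S: the first block gives v(x) = d₁ + 1 (the cofactor is a unit),
      -- and in every later block x - offset = (m - c) p with m - c a unit
      val-f : ∀ u → Unit u → m ≡ pw d₁ * u → ∀ t → Val (prodAt x (roots (suc t))) (suc d₁ ℕ.+ t)
      val-f u uu em zero = Val-cong (sym (trans (prodAt-roots-suc x 0) (cong (_* 1ℤ) (prodAt-block0 x)))) refl
        (Val-mul (Val-mul (Val-unit unit-Q) val-x) (Val-unit unit-1))
        where
        regroup : ∀ w u P → w * u * P ≡ P * w * u
        regroup = solve-∀
        val-x : Val x (suc d₁)
        val-x = val u (trans (cong (_* P) em) (trans (regroup (pw d₁) u P) (cong (_* u) (sym (pw-suc d₁))))) uu
      val-f u uu em (suc t) = Val-cong (sym (prodAt-roots-suc x (suc t))) (sym (NP.+-suc (suc d₁) t))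
          (Val-mul val-f-block (val-f u uu em t))
        where
        c : ℤ
        c = 1ℤ + P * + t
        P∣m : P ∣ m
        P∣m = subst (P ∣_) (sym em) (∣m⇒∣m*n u (P∣pw d))
        unit-m-c : Unit (m - c)
        unit-m-c dd = unit-1 (subst (P ∣_) (cancel m (P * + t)) (∣m∣n⇒∣m-n (∣m∣n⇒∣m-n P∣m dd) (∣m⇒∣m*n (+ t) ∣-refl)))
          where cancel : ∀ m a → m - (m - (1ℤ + a)) - a ≡ 1ℤ
                cancel = solve-∀
        x-offset : x - offset (suc t) ≡ (m - c) * P
        x-offset = factor m P (+ t)
          where factor : ∀ m P t → m * P - P * (1ℤ + P * t) ≡ (m - (1ℤ + P * t)) * P
                factor = solve-∀
        val-f-block : Val (prodAt x (blockL (offset (suc t)) p)) 1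
        val-f-block = Val-cong (sym (trans (prodAt-block x (offset (suc t))) (cong (λ z → cofactor z * z) x-offset))) refl
          (Val-mul (Val-unit (cofactor-unit ((m - c) * P) (∣n⇒∣m*n (m - c) ∣-refl)))
             (Val-cong (trans (cong (_* (m - c)) pw-1) (ℤP.*-comm P (m - c))) refl (Val-scale 1 (Val-unit unit-m-c))))

      -- v(B) = min(v(m), d₁) unless v(m) = d₁, and in that case v(f x) = S
      upper-val : ∀ e u → m ≡ pw e * u → Unit u → pw (suc S) ∣ prodAt x (roots s) → pw (suc S) ∣ eval h x → ⊥
      upper-val e u em uu df dh with NP.<-cmp e d₁
      ... | tri< e<d₁ _ _ = Val-notHigher val-B (∣-trans (pw-mono (s≤s (NP.<⇒≤ e<d₁))) (pw∣B dh))
        where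
        k = d₁ ∸ suc e
        regroup : ∀ w u W v → w * (u * W + v) ≡ w * u * W + w * v
        regroup = solve-∀
        d₁≡ : d₁ ≡ e ℕ.+ suc k
        d₁≡ = trans (sym (NP.m+[n∸m]≡n e<d₁)) (sym (NP.+-suc e k))
        B≡ : pw e * (u * W + pw (suc k)) ≡ B
        B≡ = trans (regroup (pw e) u W (pw (suc k))) (cong₂ (λ a b → a * W + b) (sym em) (trans (sym (pw-+ e (suc k))) (cong pw (sym d₁≡))))
        val-B : Val B e
        val-B = Val-cong B≡ (NP.+-identityʳ e) (Val-scale e (Val-unit (unit-+ (unit-* uu unit-W) (P∣pw k))))
      ... | tri> _ _ d₁<e = Val-notHigher val-B (pw∣B dh)
        where
        k = e ∸ suc d₁
        regroup : ∀ w v u W → w * (1ℤ + v * (u * W)) ≡ w * v * u * W + w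
        regroup = solve-∀
        e≡ : e ≡ d₁ ℕ.+ suc k
        e≡ = trans (sym (NP.m+[n∸m]≡n d₁<e)) (sym (NP.+-suc d₁ k))
        B≡ : pw d₁ * (1ℤ + pw (suc k) * (u * W)) ≡ B
        B≡ = trans (regroup (pw d₁) (pw (suc k)) u W)
               (trans (cong (λ a → a * u * W + pw d₁) (trans (sym (pw-+ d₁ (suc k))) (cong pw (sym e≡))))
                      (cong (λ a → a * W + pw d₁) (sym em)))
        val-B : Val B d₁
        val-B = Val-cong B≡ (NP.+-identityʳ d₁) (Val-scale d₁ (Val-unit (unit-+ unit-1 (∣m⇒∣m*n (u * W) (P∣pw k)))))
      ... | tri≈ _ refl _ = Val-notHigher (Val-cong refl (exponents s₂ d) (val-f u uu em s₁)) df
        where exponents : ∀ s₂ d → suc (suc d) ℕ.+ suc s₂ ≡ suc (suc s₂) ℕ.+ suc d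
              exponents = NRS.solve-∀

      upper-multiple : pw (suc S) ∣ prodAt x (roots s) → pw (suc S) ∣ eval h x → ⊥
      upper-multiple df dh with m ℤ.≟ 0ℤ
      ... | yes m≡0 = Val-notHigher (Val-pw d₁) (subst (pw (suc d₁) ∣_) B≡ (pw∣B dh))
        where B≡ : B ≡ pw d₁
              B≡ = trans (cong (λ a → a * W + pw d₁) m≡0) (trans (cong (_+ pw d₁) (ℤP.*-zeroˡ W)) (ℤP.+-identityˡ (pw d₁)))
      ... | no m≢0 with valExists m m≢0
      ...   | e , val u em uu = upper-val e u em uu df dh

-- p^(S+1) never divides both f n and h n: for p ∤ n already v(h n) = s
    upper : ∀ n → pw (suc S) ∣ prodAt n (roots s) → pw (suc S) ∣ eval h n → ⊥
    upper n df dh with P ∣? n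
    ... | no p∤n = Val-notHigher (val-h-unit n p∤n) (∣-trans (pw-mono (s≤s (NP.m≤m+n s d₁))) dh)
    ... | yes (divides m refl) = AtMultiple.upper-multiple m df dh

    certificate : Certificate (roots s) h s S (sumE E s)
    certificate = record
      { deg-h<deg-f   = length-h
      ; val-resultant = Val-prodEval-roots h E s val-block
      ; exponent      = exponent-identity (sumE E s) S (p ℕ.* (s ℕ.* s)) s (trans (cong (ℕ._+ s) (sumE-E s₁)) (total S q s₁))
      ; lower         = λ n → pw∣prodAt-roots n s , lower-h n
      ; upper         = upper
      ; attains-min   = 1ℤ , gcdAtRoot (prodAt 1ℤ (roots s)) (eval h 1ℤ) s (prodAt-roots-zero 1ℤ s₁ block0-root-1) (val-h-unit 1ℤ unit-1)
      ; attains-max   = 0ℤ , gcdAtRoot (prodAt 0ℤ (roots s)) (eval h 0ℤ) S (prodAt-roots-zero 0ℤ s₁ block0-root-0) val-h-0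
      }
      where
      total : ∀ S q s₁ → (S ℕ.+ suc q ℕ.* suc s₁) ℕ.+ s₁ ℕ.* (suc s₁ ℕ.+ suc q ℕ.* suc s₁) ℕ.+ suc s₁ ≡ suc (suc q) ℕ.* (suc s₁ ℕ.* suc s₁) ℕ.+ S
      total = NRS.solve-∀

  realises : ∀ s S → s ≤ S → Realises p s S
  realises zero S _ = certificate⇒realises _ _ 0 S S (certificate-s=0 S)
  realises (suc s₁) S s≤S with NP.m≤n⇒m<n∨m≡n s≤S
  ... | inj₂ refl = certificate⇒realises _ _ (suc s₁) (suc s₁) _ (certificate-s=S s₁)
  ... | inj₁ s<S = subst (Realises p (suc s₁)) S≡ (strict s₁)
    where
    d = S ∸ suc (suc s₁)
    S≡ : suc s₁ ℕ.+ suc d ≡ S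
    S≡ = trans (NP.+-suc (suc s₁) d) (NP.m+[n∸m]≡n s<S)
    strict : ∀ s₁ → Realises p (suc s₁) (suc s₁ ℕ.+ suc d)
    strict zero = certificate⇒realises _ _ 1 (suc (suc d)) _ (CaseOne.certificate d)
    strict (suc s₂) = certificate⇒realises _ _ (suc (suc s₂)) (suc (suc s₂) ℕ.+ suc d) _ (CaseMany.certificate s₂ d)

-- The theorem.  A prime is at least 2, so it has the form q + 2 required by Construction.
-- The constructions work for every prime.
mainTheorem7 : (p : ℕ) → Prime p → (s S : ℕ) → s ≤ S →
    (p ≡ 2 → 2 ≤ s → 2 ℕ.* s ℕ.+ 1 ≤ S) →
    Σ Poly λ f → Σ Poly λ g →
      Monic f × Monic g × resultant f g ≢ 0ℤ
      × MinVal p (gcdAt f g) s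
      × MaxVal p (gcdAt f g) S
      × (∃ λ k → IsVal p (resultant f g) k
                 × (+ k - + S ≡ + (p ℕ.* (s ℕ.* s)) - + s))
mainTheorem7 p isPrime s S s≤S _ with ℕ.nonTrivial⇒n>1 p {{prime⇒nonTrivial isPrime}}
... | s≤s (s≤s _) = Construction.realises _ isPrime s S s≤S
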